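{- Let $m$ be a positive integer and let $A_0=I_m, A_1, A_2$ be the adjacency matrices of a non-symmetric association scheme of class $2$ on $m$ points (so $A_2=A_1^\top$). Let $\mathbf{1}$ denote the all-one row vector of length $m$, and define the $2(m+1)\times 2(m+1)$ matrices, written in block form with respect to a partition of the index set into consecutive blocks of sizes $1,m,m,1$: \[ C_0=I_{2(m+1)},\qquad C_1=\begin{bmatrix} 0&\mathbf{1}&0&0 \\ 0&A_1&A_2&\mathbf{1}^\top \\ \mathbf{1}^\top&A_2&A_1&0 \\ 0&0&\mathbf{1}&0 \end{bmatrix},\qquad C_2=C_1^\top,\qquad C_3=J-C_0-C_1-C_2, \] where $J$ is the all-one matrix. Then $\{C_0,C_1,C_2,C_3\}$ is the set of adjacency matrices of an association scheme of class $3$ on $2(m+1)$ points (called the extended double cover), and its first eigenmatrix is \[ \begin{bmatrix} 1&m&m&1 \\ 1&\sqrt{ -m}&-\sqrt{ -m}&-1 \\ 1&-\sqrt{ -m}&\sqrt{ -m} &-1\\ 1&-1&-1&1 \end{bmatrix} \] (for a suitable ordering of the primitive idempotents), where $\sqrt{ -m}=i\sqrt{m}$.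
   Context: A (commutative) association scheme of class $d$ on a finite set $X$ with $|X|=n$ is given by $0/1$ matrices $A_0=I_n,A_1,\dots,A_d$ (adjacency matrices) with $\sum_{i} A_i=J$, the set $\{A_i\}$ closed under transposition, and the linear span $\mathcal{A}=\langle A_0,\dots,A_d\rangle$ (the Bose--Mesner algebra) closed under matrix multiplication and commutative. It is non-symmetric if some $A_i$ is not symmetric. $\mathcal{A}$ has a basis of primitive idempotents $E_0=\frac1n J,E_1,\dots,E_d$, and the first eigenmatrix $P=(P_{i,j})_{0\le i,j\le d}$ is defined by $A_j=\sum_{i} P_{i,j}E_i$, i.e. $(A_0,\dots,A_d)=(E_0,\dots,E_d)P$. -}

module Defs where

open import Data.Nat as ℕ using (ℕ; zero; suc; _∸_)
open import Data.Integer as ℤ using (ℤ; +_)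
open import Data.Rational as ℚ using (ℚ; 0ℚ; 1ℚ)
open import Data.Fin using (Fin; zero; suc; splitAt)
open import Data.Sum using (_⊎_; inj₁; inj₂)
open import Data.Product using (Σ; _×_; _,_; ∃)
open import Relation.Binary.PropositionalEquality using (_≡_; _≢_)

Σ[<_]_ : {A : Set} → (zero' : A) → (A → A → A) → ∀ n → (Fin n → A) → A
Σ[<_]_ z _⊕_ zero f = z
Σ[<_]_ z _⊕_ (suc n) f = f zero ⊕ Σ[<_]_ z _⊕_ n (λ i → f (suc i))

Mat : ℕ → Set
Mat n = Fin n → Fin n → ℕ

sumℕ : ∀ n → (Fin n → ℕ) → ℕ
sumℕ = Σ[<_]_ 0 ℕ._+_

_·ℕ_ : ∀ {n} → Mat n → Mat n → Mat n
(M ·ℕ N) x y = sumℕ _ (λ z → M x z ℕ.* N z y)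

δ : ∀ {n} → Fin n → Fin n → ℕ
δ zero zero = 1
δ zero (suc y) = 0
δ (suc x) zero = 0
δ (suc x) (suc y) = δ x y

record IsScheme (d n : ℕ) (A : Fin (suc d) → Mat n) : Set where
  field
    zero-one   : ∀ i x y → (A i x y ≡ 0) ⊎ (A i x y ≡ 1)
    nonzero    : ∀ i → Σ (Fin n) λ x → Σ (Fin n) λ y → A i x y ≡ 1
    A₀-is-I    : ∀ x y → A zero x y ≡ δ x y
    sum-is-J   : ∀ x y → sumℕ (suc d) (λ i → A i x y) ≡ 1
    transpose-closed : ∀ i → Σ (Fin (suc d)) λ j → ∀ x y → A i y x ≡ A j x y
    product-closed : ∀ i j → Σ (Fin (suc d) → ℕ) λ p →
                       ∀ x y → (A i ·ℕ A j) x y ≡ sumℕ (suc d) (λ k → p k ℕ.* A k x y)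
    commutative : ∀ i j x y → (A i ·ℕ A j) x y ≡ (A j ·ℕ A i) x y

NonSymmetric : ∀ {d n} → (Fin (suc d) → Mat n) → Set
NonSymmetric {d} {n} A = Σ (Fin (suc d)) λ i → Σ (Fin n) λ x → Σ (Fin n) λ y → A i x y ≢ A i y x

N : ℕ → ℕ
N m = suc (m ℕ.+ (m ℕ.+ 1))

data Blk (m : ℕ) : Set where
  top : Blk m
  b₁  : Fin m → Blk m
  b₂  : Fin m → Blk m
  bot : Blk m

blk : ∀ {m} → Fin (N m) → Blk m
blk zero = top
blk {m} (suc i) with splitAt m i
... | inj₁ a = b₁ a
... | inj₂ k with splitAt m {1} k
...   | inj₁ b = b₂ b
...   | inj₂ _ = bot

C₁blk : ∀ {m} → (Fin 3 → Mat m) → Blk m → Blk m → ℕ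
C₁blk A top     (b₁ b)  = 1
C₁blk A top     _       = 0
C₁blk A (b₁ a)  top     = 0
C₁blk A (b₁ a)  (b₁ b)  = A (suc zero) a b
C₁blk A (b₁ a)  (b₂ b)  = A (suc (suc zero)) a b
C₁blk A (b₁ a)  bot     = 1
C₁blk A (b₂ a)  top     = 1
C₁blk A (b₂ a)  (b₁ b)  = A (suc (suc zero)) a b
C₁blk A (b₂ a)  (b₂ b)  = A (suc zero) a b
C₁blk A (b₂ a)  bot     = 0
C₁blk A bot     (b₂ b)  = 1
C₁blk A bot     _       = 0

C : ∀ {m} → (Fin 3 → Mat m) → Fin 4 → Mat (N m)
C A zero x y = δ x y
C A (suc zero) x y = C₁blk A (blk x) (blk y)
C A (suc (suc zero)) x y = C₁blk A (blk y) (blk x)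
C A (suc (suc (suc zero))) x y =
  1 ∸ (δ x y ℕ.+ (C₁blk A (blk x) (blk y) ℕ.+ C₁blk A (blk y) (blk x)))

-- The field K_m = ℚ(√-m): pairs (a , b) standing for a + b·s with s² = -m.

record K : Set where
  constructor _+_√
  field
    re : ℚ
    im : ℚ
open K public

module _ (m : ℕ) where
  infixl 6 _⊕_
  infixl 7 _⊗_
  _⊕_ : K → K → K
  (a + b √) ⊕ (c + d √) = (a ℚ.+ c) + (b ℚ.+ d) √

  _⊗_ : K → K → K
  (a + b √) ⊗ (c + d √) =
    (a ℚ.* c ℚ.- (ℤ.+ m ℚ./ 1) ℚ.* (b ℚ.* d)) + (a ℚ.* d ℚ.+ b ℚ.* c) √

  0K 1K s : K
  0K = 0ℚ + 0ℚ √
  1K = 1ℚ + 0ℚ √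
  s  = 0ℚ + 1ℚ √

  ⊝_ : K → K
  ⊝ (a + b √) = (ℚ.- a) + (ℚ.- b) √

  ℕ→K : ℕ → K
  ℕ→K k = (ℤ.+ k ℚ./ 1) + 0ℚ √

  KMat : ℕ → Set
  KMat n = Fin n → Fin n → K

  sumK : ∀ n → (Fin n → K) → K
  sumK = Σ[<_]_ 0K _⊕_

  _·K_ : ∀ {n} → KMat n → KMat n → KMat n
  (M ·K M') x y = sumK _ (λ z → M x z ⊗ M' z y)

  embed : ∀ {n} → Mat n → KMat n
  embed M x y = ℕ→K (M x y)

  record IsPrimitiveIdempotentBasis (n : ℕ) .{{_ : ℕ.NonZero n}}
           (A : Fin 4 → Mat n) (E : Fin 4 → KMat n) : Set where
    field
      E₀-is-J/n   : ∀ x y → E zero x y ≡ ((ℤ.+ 1 ℚ./ n) + 0ℚ √)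
      in-algebra  : ∀ i → Σ (Fin 4 → K) λ c →
                      ∀ x y → E i x y ≡ sumK 4 (λ j → c j ⊗ embed (A j) x y)
      orthogonal-idempotent : ∀ i j x y →
                      (E i ·K E j) x y ≡ (ℕ→K (δ i j) ⊗ E i x y)
      nonzero     : ∀ i → Σ (Fin n) λ x → Σ (Fin n) λ y → E i x y ≢ 0K
      sum-is-I    : ∀ x y → sumK 4 (λ i → E i x y) ≡ ℕ→K (δ x y)

  -- the claimed first eigenmatrix, P i j (row i ↔ E_i, column j ↔ C_j)
  P : Fin 4 → Fin 4 → K
  P zero j = ℕ→K (row j) where
    row : Fin 4 → ℕ
    row zero = 1
    row (suc zero) = m
    row (suc (suc zero)) = m
    row (suc (suc (suc zero))) = 1
  P (suc zero) zero = 1K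
  P (suc zero) (suc zero) = s
  P (suc zero) (suc (suc zero)) = ⊝ s
  P (suc zero) (suc (suc (suc zero))) = ⊝ 1K
  P (suc (suc zero)) zero = 1K
  P (suc (suc zero)) (suc zero) = ⊝ s
  P (suc (suc zero)) (suc (suc zero)) = s
  P (suc (suc zero)) (suc (suc (suc zero))) = ⊝ 1K
  P (suc (suc (suc zero))) zero = 1K
  P (suc (suc (suc zero))) (suc zero) = ⊝ 1K
  P (suc (suc (suc zero))) (suc (suc zero)) = ⊝ 1K
  P (suc (suc (suc zero))) (suc (suc (suc zero))) = 1K

  HasFirstEigenmatrix : ∀ {n} → (Fin 4 → Mat n) → (Fin 4 → KMat n) → Set
  HasFirstEigenmatrix {n} A E =
    ∀ j x y → embed (A j) x y ≡ sumK 4 (λ i → P i j ⊗ E i x y)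

module Submission where

-- A non-symmetric scheme of class 2 is carried by A₁ (with A₂ = A₁ᵀ): A₁ has constant row and
-- column sums k, m = 2k + 1, and (A₁A₂)(x, y) = μ for x ≠ y with k = 2μ + 1, which gives
-- A₁² + A₂² = k(A₁ + A₂) and A₁A₂ + A₂A₁ + J = mI + k(A₁ + A₂). On the cover, C₃ is the
-- permutation matrix of the involution swapping the two copies of every block and
-- C₂ = C₃C₁ = C₁C₃, so the algebra is closed as soon as C₁² = kC₁ + kC₂ + mC₃, which a blockwise
-- computation derives from the two identities. The primitive idempotents are explicit
-- combinations of C₀, …, C₃ over ℚ(√-m); their orthogonality and C_j = Σ_i P_ij E_i are finitely
-- many polynomial identities in k (reading (√-m)² = -(2k + 1)), checked by reflecting them into
-- the ring solver for ℚ.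

open import Defs
open import Algebra.Bundles using (CommutativeSemiring)
open import Algebra.Core using (Op₂)
open import Algebra.Structures using (IsCommutativeSemiring; IsCommutativeMonoid)
open import Algebra.Definitions using (Associative; Commutative; LeftIdentity)
open import Data.Nat as ℕ using (ℕ; zero; suc; _+_; _*_; _∸_; _≤_)
import Data.Nat.Properties as ℕₚ
open import Data.Nat.Tactic.RingSolver using (solve-∀)
open import Data.Integer as ℤ using (ℤ)
import Data.Integer.Properties as ℤₚ
open import Data.Rational as ℚ using (ℚ; 0ℚ; 1ℚ; mkℚ)
import Data.Rational.Properties as ℚₚ
import Data.Nat.Coprimality as Coprimality
open import Data.Fin using (Fin; zero; suc; fromℕ; _↑ˡ_; _↑ʳ_; splitAt; opposite; _≟_)
open import Data.Fin.Properties using (splitAt-↑ˡ; splitAt-↑ʳ; splitAt⁻¹-↑ˡ; splitAt⁻¹-↑ʳ)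
open import Data.Fin.Patterns using (0F; 1F; 2F; 3F)
open import Data.Product using (Σ; _×_; _,_; proj₁; proj₂)
open import Data.Sum using (_⊎_; inj₁; inj₂)
open import Data.Empty using (⊥-elim)
open import Data.Vec as Vec using (Vec; []; _∷_; lookup)
import Data.Vec.Properties as Vecₚ
import Data.Rational.Solver as ℚSolver
import Algebra.Structures.Biased as Biased
open import Relation.Binary.PropositionalEquality
open import Relation.Nullary using (yes; no)

kronecker : ∀ {A : Set} (0# 1# : A) {n} → Fin n → Fin n → A
kronecker 0# 1# zero    zero    = 1#
kronecker 0# 1# zero    (suc j) = 0#
kronecker 0# 1# (suc i) zero    = 0#
kronecker 0# 1# (suc i) (suc j) = kronecker 0# 1# i j

kronecker-refl : ∀ {A : Set} {0# 1# : A} {n} (i : Fin n) → kronecker 0# 1# i i ≡ 1#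
kronecker-refl zero    = refl
kronecker-refl (suc i) = kronecker-refl i

kronecker-≢ : ∀ {A : Set} {0# 1# : A} {n} {i j : Fin n} → i ≢ j → kronecker 0# 1# i j ≡ 0#
kronecker-≢ {i = zero}  {zero}  i≢j = ⊥-elim (i≢j refl)
kronecker-≢ {i = zero}  {suc j} i≢j = refl
kronecker-≢ {i = suc i} {zero}  i≢j = refl
kronecker-≢ {i = suc i} {suc j} i≢j = kronecker-≢ (λ i≡j → i≢j (cong suc i≡j))

kronecker-map : ∀ {A B : Set} (h : A → B) {0# 1# : A} {n} (i j : Fin n) →
                h (kronecker 0# 1# i j) ≡ kronecker (h 0#) (h 1#) i j
kronecker-map h zero    zero    = refl
kronecker-map h zero    (suc j) = refl
kronecker-map h (suc i) zero    = refl
kronecker-map h (suc i) (suc j) = kronecker-map h i j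

fin4-cases : ∀ {P : Fin 4 → Set} → P 0F → P 1F → P 2F → P 3F → ∀ i → P i
fin4-cases p₀ p₁ p₂ p₃ 0F = p₀
fin4-cases p₀ p₁ p₂ p₃ 1F = p₁
fin4-cases p₀ p₁ p₂ p₃ 2F = p₂
fin4-cases p₀ p₁ p₂ p₃ 3F = p₃

module FiniteSum {A : Set} {_+_ _*_ : Op₂ A} {0# 1# : A}
                 (isCommutativeSemiring : IsCommutativeSemiring _≡_ _+_ _*_ 0# 1#) where

  open IsCommutativeSemiring isCommutativeSemiring
    using (+-assoc; +-identityˡ; +-identityʳ; *-assoc; *-identityˡ; distribˡ; distribʳ; zeroˡ; zeroʳ)
  private
    semiring : CommutativeSemiring _ _
    semiring = record { isCommutativeSemiring = isCommutativeSemiring }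
  open import Algebra.Properties.CommutativeSemigroup (CommutativeSemiring.+-commutativeSemigroup semiring)
    using (interchange)
  open import Algebra.Properties.CommutativeSemigroup (CommutativeSemiring.*-commutativeSemigroup semiring)
    using () renaming (interchange to *-interchange)

  ∑ : ∀ n → (Fin n → A) → A
  ∑ = Σ[<_]_ 0# _+_

  δ# : ∀ {n} → Fin n → Fin n → A
  δ# = kronecker 0# 1#

  ∑-cong : ∀ n {f g : Fin n → A} → (∀ i → f i ≡ g i) → ∑ n f ≡ ∑ n g
  ∑-cong zero    f≗g = refl
  ∑-cong (suc n) f≗g = cong₂ _+_ (f≗g zero) (∑-cong n (λ i → f≗g (suc i)))

  ∑-zero : ∀ n → ∑ n (λ _ → 0#) ≡ 0#
  ∑-zero zero    = refl
  ∑-zero (suc n) = trans (cong (0# +_) (∑-zero n)) (+-identityˡ 0#)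

  ∑-distrib-+ : ∀ n (f g : Fin n → A) → ∑ n (λ i → f i + g i) ≡ ∑ n f + ∑ n g
  ∑-distrib-+ zero    f g = sym (+-identityˡ 0#)
  ∑-distrib-+ (suc n) f g =
    trans (cong ((f zero + g zero) +_) (∑-distrib-+ n (λ i → f (suc i)) (λ i → g (suc i))))
          (interchange (f zero) (g zero) _ _)

  *-distribˡ-∑ : ∀ n x (f : Fin n → A) → x * ∑ n f ≡ ∑ n (λ i → x * f i)
  *-distribˡ-∑ zero    x f = zeroʳ x
  *-distribˡ-∑ (suc n) x f = trans (distribˡ x _ _) (cong ((x * f zero) +_) (*-distribˡ-∑ n x (λ i → f (suc i))))

  *-distribʳ-∑ : ∀ n x (f : Fin n → A) → ∑ n f * x ≡ ∑ n (λ i → f i * x)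
  *-distribʳ-∑ zero    x f = zeroˡ x
  *-distribʳ-∑ (suc n) x f = trans (distribʳ x _ _) (cong ((f zero * x) +_) (*-distribʳ-∑ n x (λ i → f (suc i))))

  ∑-comm : ∀ n p (f : Fin n → Fin p → A) → ∑ n (λ i → ∑ p (f i)) ≡ ∑ p (λ j → ∑ n (λ i → f i j))
  ∑-comm zero    p f = sym (∑-zero p)
  ∑-comm (suc n) p f =
    trans (cong (∑ p (f zero) +_) (∑-comm n p (λ i → f (suc i)))) (sym (∑-distrib-+ p _ _))

  ∑-++ : ∀ a b (f : Fin (a ℕ.+ b) → A) → ∑ (a ℕ.+ b) f ≡ ∑ a (λ i → f (i ↑ˡ b)) + ∑ b (λ j → f (a ↑ʳ j))
  ∑-++ zero    b f = sym (+-identityˡ _)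
  ∑-++ (suc a) b f = trans (cong (f zero +_) (∑-++ a b (λ i → f (suc i)))) (sym (+-assoc _ _ _))

  ∑-δˡ : ∀ n (i : Fin n) (f : Fin n → A) → ∑ n (λ j → δ# i j * f j) ≡ f i
  ∑-δˡ (suc n) zero f = begin
    (1# * f zero) + ∑ n (λ j → 0# * f (suc j))  ≡⟨ cong₂ _+_ (*-identityˡ _) (∑-cong n (λ j → zeroˡ _)) ⟩
    f zero + ∑ n (λ _ → 0#)                     ≡⟨ cong (f zero +_) (∑-zero n) ⟩
    f zero + 0#                                 ≡⟨ +-identityʳ _ ⟩
    f zero                                      ∎
    where open ≡-Reasoning
  ∑-δˡ (suc n) (suc i) f = trans (cong₂ _+_ (zeroˡ _) (∑-δˡ n i (λ j → f (suc j)))) (+-identityˡ _)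

  ∑-pull-scalars : ∀ n a b (f g : Fin n → A) → ∑ n (λ z → (a * f z) * (b * g z)) ≡ (a * b) * ∑ n (λ z → f z * g z)
  ∑-pull-scalars n a b f g = trans (∑-cong n (λ z → *-interchange a (f z) b (g z))) (sym (*-distribˡ-∑ n (a * b) _))

  ∑-bilinear : ∀ n p q (c : Fin p → A) (d : Fin q → A) (X : Fin p → Fin n → A) (Y : Fin q → Fin n → A) →
               ∑ n (λ z → ∑ p (λ a → c a * X a z) * ∑ q (λ b → d b * Y b z)) ≡
               ∑ p (λ a → ∑ q (λ b → (c a * d b) * ∑ n (λ z → X a z * Y b z)))
  ∑-bilinear n p q c d X Y = begin
    ∑ n (λ z → ∑ p (λ a → c a * X a z) * ∑ q (λ b → d b * Y b z))
      ≡⟨ ∑-cong n (λ z → trans (*-distribʳ-∑ p _ _) (∑-cong p (λ a → *-distribˡ-∑ q _ _))) ⟩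
    ∑ n (λ z → ∑ p (λ a → ∑ q (λ b → (c a * X a z) * (d b * Y b z))))
      ≡⟨ ∑-comm n p _ ⟩
    ∑ p (λ a → ∑ n (λ z → ∑ q (λ b → (c a * X a z) * (d b * Y b z))))
      ≡⟨ ∑-cong p (λ a → ∑-comm n q _) ⟩
    ∑ p (λ a → ∑ q (λ b → ∑ n (λ z → (c a * X a z) * (d b * Y b z))))
      ≡⟨ ∑-cong p (λ a → ∑-cong q (λ b → ∑-pull-scalars n (c a) (d b) (X a) (Y b))) ⟩
    ∑ p (λ a → ∑ q (λ b → (c a * d b) * ∑ n (λ z → X a z * Y b z))) ∎
    where open ≡-Reasoning

  ∑³-factorʳ : ∀ p q r (w : Fin p → Fin q → Fin r → A) (v : Fin r → A) →
               ∑ p (λ a → ∑ q (λ b → ∑ r (λ l → w a b l * v l))) ≡ ∑ r (λ l → ∑ p (λ a → ∑ q (λ b → w a b l)) * v l)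
  ∑³-factorʳ p q r w v = begin
    ∑ p (λ a → ∑ q (λ b → ∑ r (λ l → w a b l * v l)))  ≡⟨ ∑-cong p (λ a → ∑-comm q r _) ⟩
    ∑ p (λ a → ∑ r (λ l → ∑ q (λ b → w a b l * v l)))  ≡⟨ ∑-comm p r _ ⟩
    ∑ r (λ l → ∑ p (λ a → ∑ q (λ b → w a b l * v l)))
      ≡⟨ ∑-cong r (λ l → trans (∑-cong p (λ a → sym (*-distribʳ-∑ q (v l) _))) (sym (*-distribʳ-∑ p (v l) _))) ⟩
    ∑ r (λ l → ∑ p (λ a → ∑ q (λ b → w a b l)) * v l) ∎
    where open ≡-Reasoning

module ℕ∑ = FiniteSum ℕₚ.+-*-isCommutativeSemiring
open ℕ∑ using (∑; ∑-cong; ∑-distrib-+; *-distribˡ-∑; *-distribʳ-∑; ∑-comm)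

δ#≡δ : ∀ {n} (i j : Fin n) → ℕ∑.δ# i j ≡ δ i j
δ#≡δ zero    zero    = refl
δ#≡δ zero    (suc j) = refl
δ#≡δ (suc i) zero    = refl
δ#≡δ (suc i) (suc j) = δ#≡δ i j

δ-refl : ∀ {n} (i : Fin n) → δ i i ≡ 1
δ-refl zero    = refl
δ-refl (suc i) = δ-refl i

δ-sym : ∀ {n} (i j : Fin n) → δ i j ≡ δ j i
δ-sym zero    zero    = refl
δ-sym zero    (suc j) = refl
δ-sym (suc i) zero    = refl
δ-sym (suc i) (suc j) = δ-sym i j

δ-↑ˡ : ∀ {p} q (a b : Fin p) → δ (a ↑ˡ q) (b ↑ˡ q) ≡ δ a b
δ-↑ˡ q zero    zero    = refl
δ-↑ˡ q zero    (suc b) = refl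
δ-↑ˡ q (suc a) zero    = refl
δ-↑ˡ q (suc a) (suc b) = δ-↑ˡ q a b

δ-↑ʳ : ∀ p {q} (a b : Fin q) → δ (p ↑ʳ a) (p ↑ʳ b) ≡ δ a b
δ-↑ʳ zero    a b = refl
δ-↑ʳ (suc p) a b = δ-↑ʳ p a b

δ-↑ˡ↑ʳ : ∀ p {q} (a : Fin p) (b : Fin q) → δ (a ↑ˡ q) (p ↑ʳ b) ≡ 0
δ-↑ˡ↑ʳ (suc p) zero    b = refl
δ-↑ˡ↑ʳ (suc p) (suc a) b = δ-↑ˡ↑ʳ p a b

δ-↑ʳ↑ˡ : ∀ p {q} (a : Fin p) (b : Fin q) → δ (p ↑ʳ b) (a ↑ˡ q) ≡ 0
δ-↑ʳ↑ˡ p {q} a b = trans (δ-sym (p ↑ʳ b) (a ↑ˡ q)) (δ-↑ˡ↑ʳ p a b)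

∑-δˡ : ∀ n (i : Fin n) (f : Fin n → ℕ) → ∑ n (λ j → δ i j * f j) ≡ f i
∑-δˡ n i f = trans (∑-cong n (λ j → cong (_* f j) (sym (δ#≡δ i j)))) (ℕ∑.∑-δˡ n i f)

∑-δʳ : ∀ n (i : Fin n) (f : Fin n → ℕ) → ∑ n (λ j → f j * δ j i) ≡ f i
∑-δʳ n i f = trans (∑-cong n (λ j → trans (ℕₚ.*-comm (f j) _) (cong (_* f j) (δ-sym j i)))) (∑-δˡ n i f)

δ-rowSum : ∀ n (i : Fin n) → ∑ n (δ i) ≡ 1
δ-rowSum n i = trans (∑-cong n (λ j → sym (ℕₚ.*-identityʳ (δ i j)))) (∑-δˡ n i (λ _ → 1))

∑-const : ∀ n c → ∑ n (λ _ → c) ≡ n * c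
∑-const zero    c = refl
∑-const (suc n) c = cong (c +_) (∑-const n c)

term≤∑ : ∀ n (f : Fin n → ℕ) i → f i ≤ ∑ n f
term≤∑ (suc n) f zero    = ℕₚ.m≤m+n (f zero) _
term≤∑ (suc n) f (suc i) = ℕₚ.≤-trans (term≤∑ n (λ j → f (suc j)) i) (ℕₚ.m≤n+m _ (f zero))

∑≡1⇒δ : ∀ n (f : Fin n → ℕ) {i} → ∑ n f ≡ 1 → f i ≡ 1 → ∀ j → f j ≡ δ i j
∑≡1⇒δ (suc n) f {zero} ∑f≡1 fi≡1 zero    = fi≡1
∑≡1⇒δ (suc n) f {zero} ∑f≡1 fi≡1 (suc j) =
  ℕₚ.n≤0⇒n≡0 (subst (f (suc j) ≤_) rest≡0 (term≤∑ n (λ j → f (suc j)) j))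
  where
  rest≡0 : ∑ n (λ j → f (suc j)) ≡ 0
  rest≡0 = ℕₚ.suc-injective (trans (cong (_+ ∑ n (λ j → f (suc j))) (sym fi≡1)) ∑f≡1)
∑≡1⇒δ (suc n) f {suc i} ∑f≡1 fi≡1 j with f zero in f0≡ | term≤∑ n (λ j → f (suc j)) i
... | zero  | _ = case j
  where
  case : ∀ j → f j ≡ δ (suc i) j
  case zero    = f0≡
  case (suc j) = ∑≡1⇒δ n (λ j → f (suc j)) ∑f≡1 fi≡1 j
... | suc a | fi≤rest = ⊥-elim (ℕₚ.<-irrefl refl (begin-strict
  1                              ≡⟨ sym fi≡1 ⟩
  f (suc i)                      ≤⟨ fi≤rest ⟩
  ∑ n (λ j → f (suc j))          <⟨ ℕₚ.m<n+m _ (ℕ.s≤s ℕ.z≤n) ⟩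
  suc a + ∑ n (λ j → f (suc j))  ≡⟨ ∑f≡1 ⟩
  1                              ∎))
  where open ℕₚ.≤-Reasoning

∑-select : ∀ n (c f : Fin n → ℕ) {l} → ∑ n f ≡ 1 → f l ≡ 1 → ∑ n (λ j → c j * f j) ≡ c l
∑-select n c f {l} ∑f≡1 fl≡1 =
  trans (∑-cong n (λ j → cong (c j *_) (trans (∑≡1⇒δ n f ∑f≡1 fl≡1 j) (δ-sym l j)))) (∑-δʳ n l c)

zero-one⇒idempotent : ∀ {a} → (a ≡ 0) ⊎ (a ≡ 1) → a * a ≡ a
zero-one⇒idempotent (inj₁ refl) = refl
zero-one⇒idempotent (inj₂ refl) = refl

-- The field ℚ(√-m)

toℚ : ℕ → ℚ
toℚ k = ℤ.+ k ℚ./ 1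

toℚ≡mkℚ : ∀ k → toℚ k ≡ mkℚ (ℤ.+ k) 0 (Coprimality.sym (Coprimality.1-coprimeTo k))
toℚ≡mkℚ k = ℚₚ.normalize-coprime _

toℚ-+ : ∀ a b → toℚ (a + b) ≡ toℚ a ℚ.+ toℚ b
toℚ-+ a b = begin
  toℚ (a + b)                                  ≡⟨ cong (ℚ._/ 1) (ℤₚ.pos-+ a b) ⟩
  (ℤ.+ a ℤ.+ ℤ.+ b) ℚ./ 1                      ≡⟨ cong₂ (λ x y → (x ℤ.+ y) ℚ./ 1) (sym (ℤₚ.*-identityʳ (ℤ.+ a))) (sym (ℤₚ.*-identityʳ (ℤ.+ b))) ⟩
  (ℤ.+ a ℤ.* ℤ.+ 1 ℤ.+ ℤ.+ b ℤ.* ℤ.+ 1) ℚ./ 1  ≡⟨ sym (cong₂ ℚ._+_ (toℚ≡mkℚ a) (toℚ≡mkℚ b)) ⟩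
  toℚ a ℚ.+ toℚ b                              ∎
  where open ≡-Reasoning

toℚ-* : ∀ a b → toℚ (a * b) ≡ toℚ a ℚ.* toℚ b
toℚ-* a b = trans (cong (ℚ._/ 1) (ℤₚ.pos-* a b)) (sym (cong₂ ℚ._*_ (toℚ≡mkℚ a) (toℚ≡mkℚ b)))

toℚ-inverse : ∀ n .{{_ : ℕ.NonZero n}} → (ℤ.+ 1 ℚ./ n) ℚ.* toℚ n ≡ 1ℚ
toℚ-inverse (suc n) =
  trans (cong₂ ℚ._*_ (ℚₚ.normalize-coprime (Coprimality.1-coprimeTo (suc n))) (toℚ≡mkℚ (suc n)))
        (ℚₚ.*-inverseˡ (mkℚ (ℤ.+ suc n) 0 (Coprimality.sym (Coprimality.1-coprimeTo (suc n)))))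

module QuadraticField (m : ℕ) where

  infixl 6 _+ᴷ_
  infixl 7 _*ᴷ_
  _+ᴷ_ _*ᴷ_ : K → K → K
  _+ᴷ_ = _⊕_ m
  _*ᴷ_ = _⊗_ m

  0ᴷ 1ᴷ : K
  0ᴷ = 0K m
  1ᴷ = 1K m

  ι : ℕ → K
  ι = ℕ→K m

  K-ext : ∀ {x y : K} → re x ≡ re y → im x ≡ im y → x ≡ y
  K-ext refl refl = refl

  module Q = ℚSolver.+-*-Solver

  -- Identities in K are proved by reflection: an expression is sent to the ℚ-polynomials of its
  -- real and imaginary parts, computed with (√-m)² = -m, whose normal forms are compared by the
  -- ring solver for ℚ. A variable marked real is known to have imaginary part 0.
  infixl 6 _:+_
  infixl 7 _:*_
  data KExpr (n : ℕ) : Set where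
    var real     : Fin n → KExpr n
    rat          : ℚ → KExpr n
    √-m m̂        : KExpr n
    _:+_ _:*_    : KExpr n → KExpr n → KExpr n
    :-_          : KExpr n → KExpr n

  ⟦_⟧ : ∀ {n} → KExpr n → Vec K n → K
  ⟦ var i  ⟧ ρ = lookup ρ i
  ⟦ real i ⟧ ρ = re (lookup ρ i) + 0ℚ √
  ⟦ rat q  ⟧ ρ = q + 0ℚ √
  ⟦ √-m    ⟧ ρ = s m
  ⟦ m̂      ⟧ ρ = ι m
  ⟦ a :+ b ⟧ ρ = ⟦ a ⟧ ρ +ᴷ ⟦ b ⟧ ρ
  ⟦ a :* b ⟧ ρ = ⟦ a ⟧ ρ *ᴷ ⟦ b ⟧ ρ
  ⟦ :- a   ⟧ ρ = ⊝_ m (⟦ a ⟧ ρ)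

  -- The polynomials have the real parts of the variables, then their imaginary parts, as
  -- variables; M is a polynomial denoting m.
  module _ {n} (M : Q.Polynomial (n + n)) where
    reₚ imₚ : KExpr n → Q.Polynomial (n + n)
    reₚ (var i)  = Q.var (i ↑ˡ n)
    reₚ (real i) = Q.var (i ↑ˡ n)
    reₚ (rat q)  = Q.con q
    reₚ √-m      = Q.con 0ℚ
    reₚ m̂        = M
    reₚ (a :+ b) = reₚ a Q.:+ reₚ b
    reₚ (a :* b) = reₚ a Q.:* reₚ b Q.:- M Q.:* (imₚ a Q.:* imₚ b)
    reₚ (:- a)   = Q.:- reₚ a
    imₚ (var i)  = Q.var (n ↑ʳ i)
    imₚ (real i) = Q.con 0ℚ
    imₚ (rat q)  = Q.con 0ℚ
    imₚ √-m      = Q.con 1ℚ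
    imₚ m̂        = Q.con 0ℚ
    imₚ (a :+ b) = imₚ a Q.:+ imₚ b
    imₚ (a :* b) = reₚ a Q.:* imₚ b Q.:+ imₚ a Q.:* reₚ b
    imₚ (:- a)   = Q.:- imₚ a

  env : ∀ {n} → Vec K n → Vec ℚ (n + n)
  env ρ = Vec.map re ρ Vec.++ Vec.map im ρ

  normal : ∀ {n} (M : Q.Polynomial (n + n)) → Vec K n → KExpr n → ℚ × ℚ
  normal M ρ e = Q.⟦ reₚ M e ⟧↓ (env ρ) , Q.⟦ imₚ M e ⟧↓ (env ρ)

  module _ {n} (M : Q.Polynomial (n + n)) (ρ : Vec K n) (M≡m : Q.⟦ M ⟧ (env ρ) ≡ toℚ m) where
    re-sound : ∀ e → re (⟦ e ⟧ ρ) ≡ Q.⟦ reₚ M e ⟧ (env ρ)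
    im-sound : ∀ e → im (⟦ e ⟧ ρ) ≡ Q.⟦ imₚ M e ⟧ (env ρ)
    re-sound (var i)  = sym (trans (Vecₚ.lookup-++ˡ (Vec.map re ρ) _ i) (Vecₚ.lookup-map i re ρ))
    re-sound (real i) = re-sound (var i)
    re-sound (rat q)  = refl
    re-sound √-m      = refl
    re-sound m̂        = sym M≡m
    re-sound (a :+ b) = cong₂ ℚ._+_ (re-sound a) (re-sound b)
    re-sound (a :* b) = cong₂ ℚ._-_ (cong₂ ℚ._*_ (re-sound a) (re-sound b))
                                    (cong₂ ℚ._*_ (sym M≡m) (cong₂ ℚ._*_ (im-sound a) (im-sound b)))
    re-sound (:- a)   = cong ℚ.-_ (re-sound a)
    im-sound (var i)  = sym (trans (Vecₚ.lookup-++ʳ (Vec.map re ρ) _ i) (Vecₚ.lookup-map i im ρ))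
    im-sound (real i) = refl
    im-sound (rat q)  = refl
    im-sound √-m      = refl
    im-sound m̂        = refl
    im-sound (a :+ b) = cong₂ ℚ._+_ (im-sound a) (im-sound b)
    im-sound (a :* b) = cong₂ ℚ._+_ (cong₂ ℚ._*_ (re-sound a) (im-sound b)) (cong₂ ℚ._*_ (im-sound a) (re-sound b))
    im-sound (:- a)   = cong ℚ.-_ (im-sound a)

    K-solve : ∀ l r → normal M ρ l ≡ normal M ρ r → ⟦ l ⟧ ρ ≡ ⟦ r ⟧ ρ
    K-solve l r eq = K-ext (via reₚ {re} re-sound (cong proj₁ eq)) (via imₚ {im} im-sound (cong proj₂ eq))
      where
      via : ∀ (part : Q.Polynomial (n + n) → KExpr n → Q.Polynomial (n + n)) {get : K → ℚ} →
            (∀ e → get (⟦ e ⟧ ρ) ≡ Q.⟦ part M e ⟧ (env ρ)) →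
            Q.⟦ part M l ⟧↓ (env ρ) ≡ Q.⟦ part M r ⟧↓ (env ρ) → get (⟦ l ⟧ ρ) ≡ get (⟦ r ⟧ ρ)
      via part sound nf = begin
        _                        ≡⟨ sound l ⟩
        Q.⟦ part M l ⟧ (env ρ)   ≡⟨ Q.correct (part M l) (env ρ) ⟨
        Q.⟦ part M l ⟧↓ (env ρ)  ≡⟨ nf ⟩
        Q.⟦ part M r ⟧↓ (env ρ)  ≡⟨ Q.correct (part M r) (env ρ) ⟩
        Q.⟦ part M r ⟧ (env ρ)   ≡⟨ sound r ⟨
        _                        ∎
        where open ≡-Reasoning

  private
    x̂ ŷ ẑ : KExpr 4
    x̂ = var 0F
    ŷ = var 1F
    ẑ = var 2F

    m̂ᵥ : Q.Polynomial (4 + 4)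
    m̂ᵥ = Q.var (fromℕ 3 ↑ˡ 4)

    law : ∀ l r (x y z : K) → let ρ = x ∷ y ∷ z ∷ ι m ∷ [] in
          normal m̂ᵥ ρ l ≡ normal m̂ᵥ ρ r → ⟦ l ⟧ ρ ≡ ⟦ r ⟧ ρ
    law l r x y z = K-solve m̂ᵥ (x ∷ y ∷ z ∷ ι m ∷ []) refl l r

  +ᴷ-assoc : Associative _≡_ _+ᴷ_
  +ᴷ-assoc x y z = law (x̂ :+ ŷ :+ ẑ) (x̂ :+ (ŷ :+ ẑ)) x y z refl

  +ᴷ-comm : Commutative _≡_ _+ᴷ_
  +ᴷ-comm x y = law (x̂ :+ ŷ) (ŷ :+ x̂) x y 0ᴷ refl

  +ᴷ-identityˡ : LeftIdentity _≡_ 0ᴷ _+ᴷ_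
  +ᴷ-identityˡ x = law (rat 0ℚ :+ x̂) x̂ x 0ᴷ 0ᴷ refl

  *ᴷ-assoc : Associative _≡_ _*ᴷ_
  *ᴷ-assoc x y z = law (x̂ :* ŷ :* ẑ) (x̂ :* (ŷ :* ẑ)) x y z refl

  *ᴷ-comm : Commutative _≡_ _*ᴷ_
  *ᴷ-comm x y = law (x̂ :* ŷ) (ŷ :* x̂) x y 0ᴷ refl

  *ᴷ-identityˡ : LeftIdentity _≡_ 1ᴷ _*ᴷ_
  *ᴷ-identityˡ x = law (rat 1ℚ :* x̂) x̂ x 0ᴷ 0ᴷ refl

  *ᴷ-distribʳ-+ᴷ : ∀ x y z → (y +ᴷ z) *ᴷ x ≡ y *ᴷ x +ᴷ z *ᴷ x
  *ᴷ-distribʳ-+ᴷ x y z = law ((ŷ :+ ẑ) :* x̂) (ŷ :* x̂ :+ ẑ :* x̂) x y z refl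

  *ᴷ-zeroˡ : ∀ x → 0ᴷ *ᴷ x ≡ 0ᴷ
  *ᴷ-zeroˡ x = law (rat 0ℚ :* x̂) (rat 0ℚ) x 0ᴷ 0ᴷ refl

  isCommutativeSemiring : IsCommutativeSemiring _≡_ _+ᴷ_ _*ᴷ_ 0ᴷ 1ᴷ
  isCommutativeSemiring = Biased.isCommutativeSemiringˡ record
    { +-isCommutativeMonoid = commutativeMonoid +ᴷ-assoc +ᴷ-identityˡ +ᴷ-comm
    ; *-isCommutativeMonoid = commutativeMonoid *ᴷ-assoc *ᴷ-identityˡ *ᴷ-comm
    ; distribʳ              = *ᴷ-distribʳ-+ᴷ
    ; zeroˡ                 = *ᴷ-zeroˡ
    }
    where
    commutativeMonoid : ∀ {_∙_ : Op₂ K} {ε} → Associative _≡_ _∙_ → LeftIdentity _≡_ ε _∙_ →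
                        Commutative _≡_ _∙_ → IsCommutativeMonoid _≡_ _∙_ ε
    commutativeMonoid assoc identityˡ comm = Biased.isCommutativeMonoidˡ record
      { isSemigroup = record { isMagma = record { isEquivalence = isEquivalence ; ∙-cong = cong₂ _ } ; assoc = assoc }
      ; identityˡ   = identityˡ
      ; comm        = comm
      }

  module ∑ᴷ = FiniteSum isCommutativeSemiring

  ½ᴷ : K
  ½ᴷ = (ℤ.+ 1 ℚ./ 2) + 0ℚ √

  halves : ∀ a b → ½ᴷ *ᴷ (a +ᴷ b) +ᴷ ½ᴷ *ᴷ (a +ᴷ ⊝_ m b) ≡ a
  halves a b = law (rat (ℤ.+ 1 ℚ./ 2) :* (x̂ :+ ŷ) :+ rat (ℤ.+ 1 ℚ./ 2) :* (x̂ :+ :- ŷ)) x̂ a b 0ᴷ refl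

  inverse-cancel : ∀ u v a → u *ᴷ v ≡ 1ᴷ → u *ᴷ (v *ᴷ a) ≡ a
  inverse-cancel u v a uv≡1 = trans (sym (*ᴷ-assoc u v a)) (trans (cong (_*ᴷ a) uv≡1) (*ᴷ-identityˡ a))

  1/n*ᴷn≡1 : ∀ d .{{_ : ℕ.NonZero d}} → ((ℤ.+ 1 ℚ./ d) + 0ℚ √) *ᴷ ι d ≡ 1ᴷ
  1/n*ᴷn≡1 d = K-ext
    (trans (Q.solve 3 (λ u v M → u Q.:* v Q.:- M Q.:* (Q.con 0ℚ Q.:* Q.con 0ℚ) Q.:= u Q.:* v) refl (ℤ.+ 1 ℚ./ d) (toℚ d) (toℚ m))
           (toℚ-inverse d))
    (Q.solve 2 (λ u v → u Q.:* Q.con 0ℚ Q.:+ Q.con 0ℚ Q.:* v Q.:= Q.con 0ℚ) refl (ℤ.+ 1 ℚ./ d) (toℚ d))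

  1ᴷ≢0ᴷ : 1ᴷ ≢ 0ᴷ
  1ᴷ≢0ᴷ ()

  ι-+ : ∀ a b → ι (a + b) ≡ ι a +ᴷ ι b
  ι-+ a b = K-ext (toℚ-+ a b) refl

  ι-* : ∀ a b → ι (a * b) ≡ ι a *ᴷ ι b
  ι-* a b = K-ext (trans (toℚ-* a b) (Q.solve 3 (λ x y M → x Q.:* y Q.:= x Q.:* y Q.:- M Q.:* (Q.con 0ℚ Q.:* Q.con 0ℚ)) refl (toℚ a) (toℚ b) (toℚ m)))
                  (Q.solve 2 (λ x y → Q.con 0ℚ Q.:= x Q.:* Q.con 0ℚ Q.:+ Q.con 0ℚ Q.:* y) refl (toℚ a) (toℚ b))

  ι-∑ : ∀ n (f : Fin n → ℕ) → ι (∑ n f) ≡ ∑ᴷ.∑ n (λ i → ι (f i))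
  ι-∑ zero    f = refl
  ι-∑ (suc n) f = trans (ι-+ (f zero) _) (cong (ι (f zero) +ᴷ_) (ι-∑ n (λ i → f (suc i))))

  ι-δ : ∀ {n} (i j : Fin n) → ι (δ i j) ≡ ∑ᴷ.δ# i j
  ι-δ zero    zero    = refl
  ι-δ zero    (suc j) = refl
  ι-δ (suc i) zero    = refl
  ι-δ (suc i) (suc j) = ι-δ i j


  orthogonal-scaling : ∀ {n} (i j : Fin n) (u : Fin n → K) v X → u i *ᴷ v ≡ 1ᴷ →
                       (u i *ᴷ u j) *ᴷ ((∑ᴷ.δ# i j *ᴷ v) *ᴷ X) ≡ ι (δ i j) *ᴷ (u i *ᴷ X)
  orthogonal-scaling i j u v X uv≡1 with i ≟ j
  ... | yes refl = begin
    (u i *ᴷ u i) *ᴷ ((∑ᴷ.δ# i i *ᴷ v) *ᴷ X)  ≡⟨ cong (λ t → (u i *ᴷ u i) *ᴷ ((t *ᴷ v) *ᴷ X)) (kronecker-refl i) ⟩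
    (u i *ᴷ u i) *ᴷ ((1ᴷ *ᴷ v) *ᴷ X)         ≡⟨ cong (λ t → (u i *ᴷ u i) *ᴷ (t *ᴷ X)) (*ᴷ-identityˡ v) ⟩
    (u i *ᴷ u i) *ᴷ (v *ᴷ X)                 ≡⟨ *ᴷ-assoc (u i) (u i) (v *ᴷ X) ⟩
    u i *ᴷ (u i *ᴷ (v *ᴷ X))                 ≡⟨ cong (u i *ᴷ_) (inverse-cancel (u i) v X uv≡1) ⟩
    u i *ᴷ X                                 ≡⟨ *ᴷ-identityˡ (u i *ᴷ X) ⟨
    1ᴷ *ᴷ (u i *ᴷ X)                         ≡⟨ cong (λ t → ι t *ᴷ (u i *ᴷ X)) (δ-refl i) ⟨
    ι (δ i i) *ᴷ (u i *ᴷ X)                  ∎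
    where open ≡-Reasoning
  ... | no i≢j = begin
    (u i *ᴷ u j) *ᴷ ((∑ᴷ.δ# i j *ᴷ v) *ᴷ X)  ≡⟨ cong (λ t → (u i *ᴷ u j) *ᴷ ((t *ᴷ v) *ᴷ X)) (kronecker-≢ i≢j) ⟩
    (u i *ᴷ u j) *ᴷ ((0ᴷ *ᴷ v) *ᴷ X)         ≡⟨ cong (λ t → (u i *ᴷ u j) *ᴷ (t *ᴷ X)) (*ᴷ-zeroˡ v) ⟩
    (u i *ᴷ u j) *ᴷ (0ᴷ *ᴷ X)                ≡⟨ cong ((u i *ᴷ u j) *ᴷ_) (*ᴷ-zeroˡ X) ⟩
    (u i *ᴷ u j) *ᴷ 0ᴷ                       ≡⟨ *ᴷ-comm (u i *ᴷ u j) 0ᴷ ⟩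
    0ᴷ *ᴷ (u i *ᴷ u j)                       ≡⟨ *ᴷ-zeroˡ (u i *ᴷ u j) ⟩
    0ᴷ                                       ≡⟨ *ᴷ-zeroˡ (u i *ᴷ X) ⟨
    0ᴷ *ᴷ (u i *ᴷ X)                         ≡⟨ cong (_*ᴷ (u i *ᴷ X)) (trans (ι-δ i j) (kronecker-≢ i≢j)) ⟨
    ι (δ i j) *ᴷ (u i *ᴷ X)                  ∎
    where open ≡-Reasoning

-- Association schemes

module IntersectionNumbers {d n} {A : Fin (suc d) → Mat n} (scheme : IsScheme d n A) where
  open IsScheme scheme

  p : Fin (suc d) → Fin (suc d) → Fin (suc d) → ℕ
  p i j = proj₁ (product-closed i j)

  ·-in-relation : ∀ {l x y} i j → A l x y ≡ 1 → (A i ·ℕ A j) x y ≡ p i j l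
  ·-in-relation {x = x} {y} i j Alxy≡1 =
    trans (proj₂ (product-closed i j) x y) (∑-select (suc d) (p i j) (λ l → A l x y) (sum-is-J x y) Alxy≡1)

module ClassTwo {m} {A : Fin 3 → Mat m} (scheme : IsScheme 2 m A)
                (A₂≡A₁ᵀ : ∀ x y → A 2F x y ≡ A 1F y x) where
  open IsScheme scheme
  open IntersectionNumbers scheme

  A₁ A₂ : Mat m
  A₁ = A 1F
  A₂ = A 2F

  partition : ∀ a b → δ a b + (A₁ a b + A₂ a b) ≡ 1
  partition a b =
    trans (cong₂ _+_ (sym (A₀-is-I a b)) (cong (A₁ a b +_) (sym (ℕₚ.+-identityʳ _)))) (sum-is-J a b)

  A₁*A₂≡0 : ∀ a b → A₁ a b * A₂ a b ≡ 0
  A₁*A₂≡0 a b with zero-one 1F a b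
  ... | inj₁ A₁ab≡0 = cong (_* A₂ a b) A₁ab≡0
  ... | inj₂ A₁ab≡1 = trans (cong (_* A₂ a b) A₁ab≡1) (trans (ℕₚ.*-identityˡ _) A₂ab≡0)
    where
    δ+A₂≡0 : δ a b + A₂ a b ≡ 0
    δ+A₂≡0 = ℕₚ.suc-injective (begin
      suc (δ a b + A₂ a b)       ≡⟨ ℕₚ.+-suc (δ a b) _ ⟨
      δ a b + (1 + A₂ a b)       ≡⟨ cong (λ t → δ a b + (t + A₂ a b)) A₁ab≡1 ⟨
      δ a b + (A₁ a b + A₂ a b)  ≡⟨ partition a b ⟩
      1                          ∎)
      where open ≡-Reasoning
    A₂ab≡0 : A₂ a b ≡ 0
    A₂ab≡0 = ℕₚ.m+n≡0⇒n≡0 (δ a b) δ+A₂≡0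

  A₀-diagonal : ∀ a → A 0F a a ≡ 1
  A₀-diagonal a = trans (A₀-is-I a a) (δ-refl a)

  x₁ y₁ : Fin m
  x₁ = proj₁ (nonzero 1F)
  y₁ = proj₁ (proj₂ (nonzero 1F))

  A₁x₁y₁≡1 : A₁ x₁ y₁ ≡ 1
  A₁x₁y₁≡1 = proj₂ (proj₂ (nonzero 1F))

  k μ : ℕ
  k = p 1F 2F 0F
  μ = p 1F 2F 1F

  A₁-rowSum : ∀ a → ∑ m (A₁ a) ≡ k
  A₁-rowSum a = begin
    ∑ m (A₁ a)      ≡⟨ ∑-cong m (λ z → sym (trans (cong (A₁ a z *_) (A₂≡A₁ᵀ z a)) (zero-one⇒idempotent (zero-one 1F a z)))) ⟩
    (A₁ ·ℕ A₂) a a  ≡⟨ ·-in-relation 1F 2F (A₀-diagonal a) ⟩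
    k               ∎
    where open ≡-Reasoning

  A₂-rowSum : ∀ a → ∑ m (A₂ a) ≡ k
  A₂-rowSum a = begin
    ∑ m (A₂ a)      ≡⟨ ∑-cong m (λ z → sym (trans (cong (A₂ a z *_) (sym (A₂≡A₁ᵀ a z))) (zero-one⇒idempotent (zero-one 2F a z)))) ⟩
    (A₂ ·ℕ A₁) a a  ≡⟨ commutative 2F 1F a a ⟩
    (A₁ ·ℕ A₂) a a  ≡⟨ ·-in-relation 1F 2F (A₀-diagonal a) ⟩
    k               ∎
    where open ≡-Reasoning

  A₁-colSum : ∀ b → ∑ m (λ a → A₁ a b) ≡ k
  A₁-colSum b = trans (∑-cong m (λ a → sym (A₂≡A₁ᵀ b a))) (A₂-rowSum b)

  A₂-colSum : ∀ b → ∑ m (λ a → A₂ a b) ≡ k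
  A₂-colSum b = trans (∑-cong m (λ a → A₂≡A₁ᵀ a b)) (A₁-rowSum b)

  m≡1+2k : m ≡ suc (k + k)
  m≡1+2k = begin
    m                                           ≡⟨ trans (sym (ℕₚ.*-identityʳ m)) (sym (∑-const m 1)) ⟩
    ∑ m (λ _ → 1)                               ≡⟨ ∑-cong m (λ b → sym (partition x₁ b)) ⟩
    ∑ m (λ b → δ x₁ b + (A₁ x₁ b + A₂ x₁ b))    ≡⟨ ∑-distrib-+ m _ _ ⟩
    ∑ m (δ x₁) + ∑ m (λ b → A₁ x₁ b + A₂ x₁ b)  ≡⟨ cong₂ _+_ (δ-rowSum m x₁) (∑-distrib-+ m _ _) ⟩
    1 + (∑ m (A₁ x₁) + ∑ m (A₂ x₁))             ≡⟨ cong suc (cong₂ _+_ (A₁-rowSum x₁) (A₂-rowSum x₁)) ⟩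
    suc (k + k)                                 ∎
    where open ≡-Reasoning

  k≢0 : ℕ.NonZero k
  k≢0 = ℕ.>-nonZero (subst₂ _≤_ A₁x₁y₁≡1 (A₁-rowSum x₁) (term≤∑ m (A₁ x₁) y₁))

  expand : ∀ i j a b → (A i ·ℕ A j) a b ≡ p i j 0F * δ a b + (p i j 1F * A₁ a b + p i j 2F * A₂ a b)
  expand i j a b = trans (proj₂ (product-closed i j) a b)
    (cong₂ _+_ (cong (p i j 0F *_) (A₀-is-I a b)) (cong (p i j 1F * A₁ a b +_) (ℕₚ.+-identityʳ _)))

  rowSum-· : ∀ i j → (∀ a → ∑ m (A i a) ≡ k) → (∀ a → ∑ m (A j a) ≡ k) →
             k * k ≡ p i j 0F + (p i j 1F * k + p i j 2F * k)
  rowSum-· i j rowᵢ rowⱼ = begin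
    k * k                                       ≡⟨ cong (_* k) (rowᵢ x₁) ⟨
    ∑ m (A i x₁) * k                            ≡⟨ *-distribʳ-∑ m k (A i x₁) ⟩
    ∑ m (λ z → A i x₁ z * k)                    ≡⟨ ∑-cong m (λ z → cong (A i x₁ z *_) (rowⱼ z)) ⟨
    ∑ m (λ z → A i x₁ z * ∑ m (A j z))          ≡⟨ ∑-cong m (λ z → *-distribˡ-∑ m (A i x₁ z) (A j z)) ⟩
    ∑ m (λ z → ∑ m (λ b → A i x₁ z * A j z b))  ≡⟨ ∑-comm m m _ ⟩
    ∑ m (λ b → (A i ·ℕ A j) x₁ b)               ≡⟨ ∑-cong m (expand i j x₁) ⟩
    ∑ m (λ b → P₀ * δ x₁ b + (P₁ * A₁ x₁ b + P₂ * A₂ x₁ b))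
      ≡⟨ trans (∑-distrib-+ m _ _) (cong (∑ m (λ b → P₀ * δ x₁ b) +_) (∑-distrib-+ m _ _)) ⟩
    ∑ m (λ b → P₀ * δ x₁ b) + (∑ m (λ b → P₁ * A₁ x₁ b) + ∑ m (λ b → P₂ * A₂ x₁ b))
      ≡⟨ cong₂ _+_ (sym (*-distribˡ-∑ m P₀ (δ x₁)))
                     (cong₂ _+_ (sym (*-distribˡ-∑ m P₁ (A₁ x₁))) (sym (*-distribˡ-∑ m P₂ (A₂ x₁)))) ⟩
    P₀ * ∑ m (δ x₁) + (P₁ * ∑ m (A₁ x₁) + P₂ * ∑ m (A₂ x₁))
      ≡⟨ cong₂ _+_ (trans (cong (P₀ *_) (δ-rowSum m x₁)) (ℕₚ.*-identityʳ P₀))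
                     (cong₂ _+_ (cong (P₁ *_) (A₁-rowSum x₁)) (cong (P₂ *_) (A₂-rowSum x₁))) ⟩
    P₀ + (P₁ * k + P₂ * k)                            ∎
    where
    open ≡-Reasoning
    P₀ P₁ P₂ : ℕ
    P₀ = p i j 0F
    P₁ = p i j 1F
    P₂ = p i j 2F

  A₁A₂-symmetric : ∀ a b → (A₁ ·ℕ A₂) a b ≡ (A₁ ·ℕ A₂) b a
  A₁A₂-symmetric a b = ∑-cong m (λ z →
    trans (cong₂ _*_ (sym (A₂≡A₁ᵀ z a)) (A₂≡A₁ᵀ z b)) (ℕₚ.*-comm (A₂ z a) (A₁ b z)))

  μ≡p²₁₂ : μ ≡ p 1F 2F 2F
  μ≡p²₁₂ = begin
    μ                 ≡⟨ ·-in-relation 1F 2F A₁x₁y₁≡1 ⟨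
    (A₁ ·ℕ A₂) x₁ y₁  ≡⟨ A₁A₂-symmetric x₁ y₁ ⟩
    (A₁ ·ℕ A₂) y₁ x₁  ≡⟨ ·-in-relation 1F 2F (trans (A₂≡A₁ᵀ y₁ x₁) A₁x₁y₁≡1) ⟩
    p 1F 2F 2F        ∎
    where open ≡-Reasoning

  k≡1+2μ : k ≡ suc (μ + μ)
  k≡1+2μ = ℕₚ.*-cancelˡ-≡ k _ k {{k≢0}} (begin
    k * k                         ≡⟨ rowSum-· 1F 2F A₁-rowSum A₂-rowSum ⟩
    k + (μ * k + p 1F 2F 2F * k)  ≡⟨ cong (λ t → k + (μ * k + t * k)) μ≡p²₁₂ ⟨
    k + (μ * k + μ * k)           ≡⟨ factor k μ ⟩
    k * suc (μ + μ)               ∎)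
    where
    open ≡-Reasoning
    factor : ∀ k μ → k + (μ * k + μ * k) ≡ k * suc (μ + μ)
    factor = solve-∀

  p⁰₁₁≡0 : p 1F 1F 0F ≡ 0
  p⁰₁₁≡0 = begin
    p 1F 1F 0F                     ≡⟨ ·-in-relation 1F 1F (A₀-diagonal x₁) ⟨
    ∑ m (λ z → A₁ x₁ z * A₁ z x₁)  ≡⟨ ∑-cong m (λ z → trans (cong (A₁ x₁ z *_) (sym (A₂≡A₁ᵀ x₁ z))) (A₁*A₂≡0 x₁ z)) ⟩
    ∑ m (λ _ → 0)                  ≡⟨ ∑-const m 0 ⟩
    m * 0                          ≡⟨ ℕₚ.*-zeroʳ m ⟩
    0                              ∎
    where open ≡-Reasoning

  p¹₁₁+p²₁₁≡k : p 1F 1F 1F + p 1F 1F 2F ≡ k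
  p¹₁₁+p²₁₁≡k = sym (ℕₚ.*-cancelˡ-≡ k _ k {{k≢0}} (begin
    k * k                                           ≡⟨ rowSum-· 1F 1F A₁-rowSum A₁-rowSum ⟩
    p 1F 1F 0F + (p 1F 1F 1F * k + p 1F 1F 2F * k)  ≡⟨ cong (_+ (p 1F 1F 1F * k + p 1F 1F 2F * k)) p⁰₁₁≡0 ⟩
    p 1F 1F 1F * k + p 1F 1F 2F * k                 ≡⟨ ℕₚ.*-distribʳ-+ k (p 1F 1F 1F) _ ⟨
    (p 1F 1F 1F + p 1F 1F 2F) * k                   ≡⟨ ℕₚ.*-comm _ k ⟩
    k * (p 1F 1F 1F + p 1F 1F 2F)                   ∎))
    where open ≡-Reasoning

  A₁²+A₂² : ∀ a b → (A₁ ·ℕ A₁) a b + (A₂ ·ℕ A₂) a b ≡ k * A₁ a b + k * A₂ a b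
  A₁²+A₂² a b = begin
    (A₁ ·ℕ A₁) a b + (A₂ ·ℕ A₂) a b
      ≡⟨ cong ((A₁ ·ℕ A₁) a b +_) (∑-cong m (λ z → trans (cong₂ _*_ (A₂≡A₁ᵀ a z) (A₂≡A₁ᵀ z b)) (ℕₚ.*-comm (A₁ z a) (A₁ b z)))) ⟩
    (A₁ ·ℕ A₁) a b + (A₁ ·ℕ A₁) b a
      ≡⟨ cong₂ _+_ (expand 1F 1F a b) (expand 1F 1F b a) ⟩
    q₀ * δ a b + (q₁ * A₁ a b + q₂ * A₂ a b) + (q₀ * δ b a + (q₁ * A₁ b a + q₂ * A₂ b a))
      ≡⟨ cong₂ (λ u w → u * δ a b + (q₁ * A₁ a b + q₂ * A₂ a b) + (u * δ b a + w)) p⁰₁₁≡0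
               (cong₂ (λ x y → q₁ * x + q₂ * y) (sym (A₂≡A₁ᵀ a b)) (A₂≡A₁ᵀ b a)) ⟩
    (q₁ * A₁ a b + q₂ * A₂ a b) + (q₁ * A₂ a b + q₂ * A₁ a b)
      ≡⟨ regroup q₁ q₂ (A₁ a b) (A₂ a b) ⟩
    (q₁ + q₂) * A₁ a b + (q₁ + q₂) * A₂ a b
      ≡⟨ cong (λ t → t * A₁ a b + t * A₂ a b) p¹₁₁+p²₁₁≡k ⟩
    k * A₁ a b + k * A₂ a b   ∎
    where
    open ≡-Reasoning
    q₀ q₁ q₂ : ℕ
    q₀ = p 1F 1F 0F
    q₁ = p 1F 1F 1F
    q₂ = p 1F 1F 2F
    regroup : ∀ q₁ q₂ x y → (q₁ * x + q₂ * y) + (q₁ * y + q₂ * x) ≡ (q₁ + q₂) * x + (q₁ + q₂) * y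
    regroup = solve-∀

  A₁A₂+A₂A₁+J : ∀ a b → (A₁ ·ℕ A₂) a b + (A₂ ·ℕ A₁) a b + 1 ≡ m * δ a b + (k * A₁ a b + k * A₂ a b)
  A₁A₂+A₂A₁+J a b = begin
    (A₁ ·ℕ A₂) a b + (A₂ ·ℕ A₁) a b + 1
      ≡⟨ cong₂ (λ u v → u + v + 1) (expand 1F 2F a b) (trans (commutative 2F 1F a b) (expand 1F 2F a b)) ⟩
    L + L + 1
      ≡⟨ cong₂ (λ t u → t + t + u) (cong (λ t → k * δ a b + (μ * A₁ a b + t * A₂ a b)) (sym μ≡p²₁₂)) (sym (partition a b)) ⟩
    L′ + L′ + (δ a b + (A₁ a b + A₂ a b))
      ≡⟨ collect {μ = μ} k≡1+2μ (δ a b) (A₁ a b) (A₂ a b) ⟩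
    suc (k + k) * δ a b + (k * A₁ a b + k * A₂ a b)
      ≡⟨ cong (λ t → t * δ a b + (k * A₁ a b + k * A₂ a b)) m≡1+2k ⟨
    m * δ a b + (k * A₁ a b + k * A₂ a b) ∎
    where
    open ≡-Reasoning
    L L′ : ℕ
    L  = k * δ a b + (μ * A₁ a b + p 1F 2F 2F * A₂ a b)
    L′ = k * δ a b + (μ * A₁ a b + μ * A₂ a b)
    collect : ∀ {k μ} → k ≡ suc (μ + μ) → ∀ d x y →
              let L = k * d + (μ * x + μ * y) in
              L + L + (d + (x + y)) ≡ suc (k + k) * d + (k * x + k * y)
    collect {μ = μ} refl = lemma μ
      where
      lemma : ∀ μ d x y → let k = suc (μ + μ) ; L = k * d + (μ * x + μ * y) in
              L + L + (d + (x + y)) ≡ suc (k + k) * d + (k * x + k * y)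
      lemma = solve-∀

-- The extended double cover

module Blocks {m : ℕ} where

  fromBlk : Blk m → Fin (N m)
  fromBlk top    = zero
  fromBlk (b₁ a) = suc (a ↑ˡ (m + 1))
  fromBlk (b₂ a) = suc (m ↑ʳ (a ↑ˡ 1))
  fromBlk bot    = suc (m ↑ʳ (m ↑ʳ zero))

  blk-fromBlk : ∀ u → blk (fromBlk u) ≡ u
  blk-fromBlk top    = refl
  blk-fromBlk (b₁ a) rewrite splitAt-↑ˡ m a (m + 1) = refl
  blk-fromBlk (b₂ a) rewrite splitAt-↑ʳ m (m + 1) (a ↑ˡ 1) | splitAt-↑ˡ m a 1 = refl
  blk-fromBlk bot    rewrite splitAt-↑ʳ m (m + 1) (m ↑ʳ zero) | splitAt-↑ʳ m 1 zero = refl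

  fromBlk-blk : ∀ x → fromBlk (blk x) ≡ x
  fromBlk-blk zero = refl
  fromBlk-blk (suc i) with splitAt m i in eq
  ... | inj₁ a = cong suc (splitAt⁻¹-↑ˡ eq)
  ... | inj₂ j with splitAt m {1} j in eq′
  ...   | inj₁ b    = cong suc (trans (cong (m ↑ʳ_) (splitAt⁻¹-↑ˡ eq′)) (splitAt⁻¹-↑ʳ eq))
  ...   | inj₂ zero = cong suc (trans (cong (m ↑ʳ_) (splitAt⁻¹-↑ʳ eq′)) (splitAt⁻¹-↑ʳ eq))

  δᴮ : Blk m → Blk m → ℕ
  δᴮ top    top    = 1
  δᴮ (b₁ a) (b₁ b) = δ a b
  δᴮ (b₂ a) (b₂ b) = δ a b
  δᴮ bot    bot    = 1
  δᴮ _      _      = 0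

  δ-fromBlk : ∀ u v → δ (fromBlk u) (fromBlk v) ≡ δᴮ u v
  δ-fromBlk top    top    = refl
  δ-fromBlk top    (b₁ b) = refl
  δ-fromBlk top    (b₂ b) = refl
  δ-fromBlk top    bot    = refl
  δ-fromBlk (b₁ a) top    = refl
  δ-fromBlk (b₁ a) (b₁ b) = δ-↑ˡ (m + 1) a b
  δ-fromBlk (b₁ a) (b₂ b) = δ-↑ˡ↑ʳ m a _
  δ-fromBlk (b₁ a) bot    = δ-↑ˡ↑ʳ m a _
  δ-fromBlk (b₂ a) top    = refl
  δ-fromBlk (b₂ a) (b₁ b) = δ-↑ʳ↑ˡ m b _
  δ-fromBlk (b₂ a) (b₂ b) = trans (δ-↑ʳ m _ _) (δ-↑ˡ 1 a b)
  δ-fromBlk (b₂ a) bot    = trans (δ-↑ʳ m _ _) (δ-↑ˡ↑ʳ m a zero)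
  δ-fromBlk bot    top    = refl
  δ-fromBlk bot    (b₁ b) = δ-↑ʳ↑ˡ m b _
  δ-fromBlk bot    (b₂ b) = trans (δ-↑ʳ m _ _) (δ-↑ʳ↑ˡ m b zero)
  δ-fromBlk bot    bot    = trans (δ-↑ʳ m _ _) (δ-↑ʳ m zero zero)

  δ-blk : ∀ x y → δ x y ≡ δᴮ (blk x) (blk y)
  δ-blk x y = trans (sym (cong₂ δ (fromBlk-blk x) (fromBlk-blk y))) (δ-fromBlk (blk x) (blk y))

  swap : Blk m → Blk m
  swap top    = bot
  swap (b₁ a) = b₂ a
  swap (b₂ a) = b₁ a
  swap bot    = top

  swap-involutive : ∀ u → swap (swap u) ≡ u
  swap-involutive top    = refl
  swap-involutive (b₁ a) = refl
  swap-involutive (b₂ a) = refl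
  swap-involutive bot    = refl

  δᴮ-swap : ∀ u v → δᴮ (swap u) v ≡ δᴮ u (swap v)
  δᴮ-swap top    top    = refl
  δᴮ-swap top    (b₁ b) = refl
  δᴮ-swap top    (b₂ b) = refl
  δᴮ-swap top    bot    = refl
  δᴮ-swap (b₁ a) top    = refl
  δᴮ-swap (b₁ a) (b₁ b) = refl
  δᴮ-swap (b₁ a) (b₂ b) = refl
  δᴮ-swap (b₁ a) bot    = refl
  δᴮ-swap (b₂ a) top    = refl
  δᴮ-swap (b₂ a) (b₁ b) = refl
  δᴮ-swap (b₂ a) (b₂ b) = refl
  δᴮ-swap (b₂ a) bot    = refl
  δᴮ-swap bot    top    = refl
  δᴮ-swap bot    (b₁ b) = refl
  δᴮ-swap bot    (b₂ b) = refl
  δᴮ-swap bot    bot    = refl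

  ∑-blocks : ∀ (f : Blk m → ℕ) → ∑ (N m) (λ z → f (blk z)) ≡ f top + (∑ m (λ a → f (b₁ a)) + (∑ m (λ a → f (b₂ a)) + f bot))
  ∑-blocks f = cong (f (blk zero) +_) (begin
    ∑ (m + (m + 1)) (λ i → g (suc i))
      ≡⟨ ℕ∑.∑-++ m (m + 1) _ ⟩
    ∑ m (λ a → g (fromBlk (b₁ a))) + ∑ (m + 1) (λ i → g (suc (m ↑ʳ i)))
      ≡⟨ cong (∑ m (λ a → g (fromBlk (b₁ a))) +_) (trans (ℕ∑.∑-++ m 1 _) (cong (∑ m (λ a → g (fromBlk (b₂ a))) +_) (ℕₚ.+-identityʳ _))) ⟩
    ∑ m (λ a → g (fromBlk (b₁ a))) + (∑ m (λ a → g (fromBlk (b₂ a))) + g (fromBlk bot))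
      ≡⟨ cong₂ _+_ (∑-cong m (λ a → cong f (blk-fromBlk (b₁ a))))
                     (cong₂ _+_ (∑-cong m (λ a → cong f (blk-fromBlk (b₂ a)))) (cong f (blk-fromBlk bot))) ⟩
    ∑ m (λ a → f (b₁ a)) + (∑ m (λ a → f (b₂ a)) + f bot) ∎)
    where
    open ≡-Reasoning
    g : Fin (N m) → ℕ
    g z = f (blk z)

C₁²-coefficients : ∀ {A : Set} (0# k m : A) → Fin 4 → A
C₁²-coefficients 0# k m 0F = 0#
C₁²-coefficients 0# k m 1F = k
C₁²-coefficients 0# k m 2F = k
C₁²-coefficients 0# k m 3F = m

-- p̃ 0# 1# k m a b l is the coefficient of C l in C a C b, for the cover of a scheme with valency k
-- on m points. The entries are drawn from 0#, 1#, k and m so that the same table can be read in ℕ,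
-- in K and as expressions over K.
p̃ : ∀ {A : Set} (0# 1# k m : A) → Fin 4 → Fin 4 → Fin 4 → A
p̃ 0# 1# k m 0F j    = kronecker 0# 1# j
p̃ 0# 1# k m 3F j    = kronecker 0# 1# (opposite j)
p̃ 0# 1# k m 1F 0F   = kronecker 0# 1# 1F
p̃ 0# 1# k m 2F 0F   = kronecker 0# 1# 2F
p̃ 0# 1# k m 1F 3F   = kronecker 0# 1# 2F
p̃ 0# 1# k m 2F 3F   = kronecker 0# 1# 1F
p̃ 0# 1# k m 1F 1F   = C₁²-coefficients 0# k m
p̃ 0# 1# k m 1F 2F l = C₁²-coefficients 0# k m (opposite l)
p̃ 0# 1# k m 2F 1F l = C₁²-coefficients 0# k m (opposite l)
p̃ 0# 1# k m 2F 2F   = C₁²-coefficients 0# k m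

C₁²-coefficients-map : ∀ {A B : Set} (h : A → B) {0# k m : A} l →
                       h (C₁²-coefficients 0# k m l) ≡ C₁²-coefficients (h 0#) (h k) (h m) l
C₁²-coefficients-map h 0F = refl
C₁²-coefficients-map h 1F = refl
C₁²-coefficients-map h 2F = refl
C₁²-coefficients-map h 3F = refl

p̃-map : ∀ {A B : Set} (h : A → B) {0# 1# k m : A} a b l →
        h (p̃ 0# 1# k m a b l) ≡ p̃ (h 0#) (h 1#) (h k) (h m) a b l
p̃-map h 0F j  l = kronecker-map h j l
p̃-map h 3F j  l = kronecker-map h (opposite j) l
p̃-map h 1F 0F l = kronecker-map h 1F l
p̃-map h 2F 0F l = kronecker-map h 2F l
p̃-map h 1F 3F l = kronecker-map h 2F l
p̃-map h 2F 3F l = kronecker-map h 1F l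
p̃-map h 1F 1F l = C₁²-coefficients-map h l
p̃-map h 1F 2F l = C₁²-coefficients-map h (opposite l)
p̃-map h 2F 1F l = C₁²-coefficients-map h (opposite l)
p̃-map h 2F 2F l = C₁²-coefficients-map h l

module DoubleCover {m} {A : Fin 3 → Mat m} (scheme : IsScheme 2 m A)
                   (A₂≡A₁ᵀ : ∀ x y → A 2F x y ≡ A 1F y x) where
  open ClassTwo scheme A₂≡A₁ᵀ
  open Blocks {m}

  C₁ᴮ : Blk m → Blk m → ℕ
  C₁ᴮ = C₁blk A

  Cᴮ : Fin 4 → Blk m → Blk m → ℕ
  Cᴮ 0F u v = δᴮ u v
  Cᴮ 1F u v = C₁ᴮ u v
  Cᴮ 2F u v = C₁ᴮ v u
  Cᴮ 3F u v = δᴮ (swap u) v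

  private
    diagonal-block : ∀ a b → δ a b + (A₁ a b + A₁ b a) + 0 ≡ 1
    diagonal-block a b =
      trans (ℕₚ.+-identityʳ _) (trans (cong (λ t → δ a b + (A₁ a b + t)) (sym (A₂≡A₁ᵀ a b))) (partition a b))

    off-diagonal-block : ∀ a b → 0 + (A₂ a b + A₂ b a) + δ a b ≡ 1
    off-diagonal-block a b = begin
      A₂ a b + A₂ b a + δ a b    ≡⟨ cong (λ t → A₂ a b + t + δ a b) (A₂≡A₁ᵀ b a) ⟩
      A₂ a b + A₁ a b + δ a b    ≡⟨ ℕₚ.+-comm _ (δ a b) ⟩
      δ a b + (A₂ a b + A₁ a b)  ≡⟨ cong (δ a b +_) (ℕₚ.+-comm (A₂ a b) _) ⟩
      δ a b + (A₁ a b + A₂ a b)  ≡⟨ partition a b ⟩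
      1                          ∎
      where open ≡-Reasoning

  partitionᴮ : ∀ u v → δᴮ u v + (C₁ᴮ u v + C₁ᴮ v u) + δᴮ (swap u) v ≡ 1
  partitionᴮ top    top    = refl
  partitionᴮ top    (b₁ b) = refl
  partitionᴮ top    (b₂ b) = refl
  partitionᴮ top    bot    = refl
  partitionᴮ (b₁ a) top    = refl
  partitionᴮ (b₁ a) (b₁ b) = diagonal-block a b
  partitionᴮ (b₁ a) (b₂ b) = off-diagonal-block a b
  partitionᴮ (b₁ a) bot    = refl
  partitionᴮ (b₂ a) top    = refl
  partitionᴮ (b₂ a) (b₁ b) = off-diagonal-block a b
  partitionᴮ (b₂ a) (b₂ b) = diagonal-block a b
  partitionᴮ (b₂ a) bot    = refl
  partitionᴮ bot    top    = refl
  partitionᴮ bot    (b₁ b) = refl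
  partitionᴮ bot    (b₂ b) = refl
  partitionᴮ bot    bot    = refl

  C-blocks : ∀ j x y → C A j x y ≡ Cᴮ j (blk x) (blk y)
  C-blocks 0F x y = δ-blk x y
  C-blocks 1F x y = refl
  C-blocks 2F x y = refl
  C-blocks 3F x y = begin
    1 ∸ (δ x y + Cᵤᵥ)                              ≡⟨ cong (λ t → 1 ∸ (t + Cᵤᵥ)) (δ-blk x y) ⟩
    1 ∸ (δᴮ u v + Cᵤᵥ)                             ≡⟨ cong (_∸ (δᴮ u v + Cᵤᵥ)) (partitionᴮ u v) ⟨
    δᴮ u v + Cᵤᵥ + δᴮ (swap u) v ∸ (δᴮ u v + Cᵤᵥ)  ≡⟨ ℕₚ.m+n∸m≡n (δᴮ u v + Cᵤᵥ) _ ⟩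
    δᴮ (swap u) v                                  ∎
    where
    open ≡-Reasoning
    u v : Blk m
    u = blk x
    v = blk y
    Cᵤᵥ : ℕ
    Cᵤᵥ = C₁ᴮ u v + C₁ᴮ v u

  Cᴮ-sum : ∀ u v → ∑ 4 (λ j → Cᴮ j u v) ≡ 1
  Cᴮ-sum u v = trans (regroup (δᴮ u v) (C₁ᴮ u v) (C₁ᴮ v u) (δᴮ (swap u) v)) (partitionᴮ u v)
    where
    regroup : ∀ a b c d → a + (b + (c + (d + 0))) ≡ a + (b + c) + d
    regroup = solve-∀

  C-sum-is-J : ∀ x y → ∑ 4 (λ j → C A j x y) ≡ 1
  C-sum-is-J x y = trans (∑-cong 4 (λ j → C-blocks j x y)) (Cᴮ-sum (blk x) (blk y))

  C₁ᴮ-swapˡ : ∀ u w → C₁ᴮ (swap u) w ≡ C₁ᴮ w u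
  C₁ᴮ-swapˡ top    top    = refl
  C₁ᴮ-swapˡ top    (b₁ c) = refl
  C₁ᴮ-swapˡ top    (b₂ c) = refl
  C₁ᴮ-swapˡ top    bot    = refl
  C₁ᴮ-swapˡ (b₁ a) top    = refl
  C₁ᴮ-swapˡ (b₁ a) (b₁ c) = A₂≡A₁ᵀ a c
  C₁ᴮ-swapˡ (b₁ a) (b₂ c) = sym (A₂≡A₁ᵀ c a)
  C₁ᴮ-swapˡ (b₁ a) bot    = refl
  C₁ᴮ-swapˡ (b₂ a) top    = refl
  C₁ᴮ-swapˡ (b₂ a) (b₁ c) = sym (A₂≡A₁ᵀ c a)
  C₁ᴮ-swapˡ (b₂ a) (b₂ c) = A₂≡A₁ᵀ a c
  C₁ᴮ-swapˡ (b₂ a) bot    = refl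
  C₁ᴮ-swapˡ bot    top    = refl
  C₁ᴮ-swapˡ bot    (b₁ c) = refl
  C₁ᴮ-swapˡ bot    (b₂ c) = refl
  C₁ᴮ-swapˡ bot    bot    = refl

  C₁ᴮ-swapʳ : ∀ w v → C₁ᴮ w (swap v) ≡ C₁ᴮ v w
  C₁ᴮ-swapʳ w v = begin
    C₁ᴮ w (swap v)         ≡⟨ C₁ᴮ-swapˡ (swap v) w ⟨
    C₁ᴮ (swap (swap v)) w  ≡⟨ cong (λ t → C₁ᴮ t w) (swap-involutive v) ⟩
    C₁ᴮ v w                ∎
    where open ≡-Reasoning

  Cᴮ-swapˡ : ∀ j u v → Cᴮ j (swap u) v ≡ Cᴮ (opposite j) u v
  Cᴮ-swapˡ 0F u v = refl
  Cᴮ-swapˡ 1F u v = C₁ᴮ-swapˡ u v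
  Cᴮ-swapˡ 2F u v = C₁ᴮ-swapʳ v u
  Cᴮ-swapˡ 3F u v = cong (λ t → δᴮ t v) (swap-involutive u)

  Cᴮ-swapʳ : ∀ j u v → Cᴮ j u (swap v) ≡ Cᴮ (opposite j) u v
  Cᴮ-swapʳ 0F u v = sym (δᴮ-swap u v)
  Cᴮ-swapʳ 1F u v = C₁ᴮ-swapʳ u v
  Cᴮ-swapʳ 2F u v = C₁ᴮ-swapˡ v u
  Cᴮ-swapʳ 3F u v = trans (δᴮ-swap u (swap v)) (cong (δᴮ u) (swap-involutive v))

  σ : Fin (N m) → Fin (N m)
  σ x = fromBlk (swap (blk x))

  C-swapˡ : ∀ j x y → C A j (σ x) y ≡ C A (opposite j) x y
  C-swapˡ j x y = begin
    C A j (σ x) y                    ≡⟨ C-blocks j (σ x) y ⟩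
    Cᴮ j (blk (σ x)) (blk y)         ≡⟨ cong (λ t → Cᴮ j t (blk y)) (blk-fromBlk (swap (blk x))) ⟩
    Cᴮ j (swap (blk x)) (blk y)      ≡⟨ Cᴮ-swapˡ j (blk x) (blk y) ⟩
    Cᴮ (opposite j) (blk x) (blk y)  ≡⟨ C-blocks (opposite j) x y ⟨
    C A (opposite j) x y             ∎
    where open ≡-Reasoning

  C-swapʳ : ∀ j x y → C A j x (σ y) ≡ C A (opposite j) x y
  C-swapʳ j x y = begin
    C A j x (σ y)                    ≡⟨ C-blocks j x (σ y) ⟩
    Cᴮ j (blk x) (blk (σ y))         ≡⟨ cong (Cᴮ j (blk x)) (blk-fromBlk (swap (blk y))) ⟩
    Cᴮ j (blk x) (swap (blk y))      ≡⟨ Cᴮ-swapʳ j (blk x) (blk y) ⟩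
    Cᴮ (opposite j) (blk x) (blk y)  ≡⟨ C-blocks (opposite j) x y ⟨
    C A (opposite j) x y             ∎
    where open ≡-Reasoning

  ⟨_⟩ : (Fin 4 → ℕ) → Mat (N m)
  ⟨ c ⟩ x y = ∑ 4 (λ l → c l * C A l x y)

  ⟨_⟩ᴮ : (Fin 4 → ℕ) → Blk m → Blk m → ℕ
  ⟨ c ⟩ᴮ u v = ∑ 4 (λ l → c l * Cᴮ l u v)

  ⟨⟩-blocks : ∀ c x y → ⟨ c ⟩ x y ≡ ⟨ c ⟩ᴮ (blk x) (blk y)
  ⟨⟩-blocks c x y = ∑-cong 4 (λ l → cong (c l *_) (C-blocks l x y))

  ⟨⟩ᴮ-at : ∀ c l u v → Cᴮ l u v ≡ 1 → ⟨ c ⟩ᴮ u v ≡ c l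
  ⟨⟩ᴮ-at c l u v = ∑-select 4 c (λ l → Cᴮ l u v) (Cᴮ-sum u v)

  ⟨δ⟩ : ∀ j x y → ⟨ ℕ∑.δ# j ⟩ x y ≡ C A j x y
  ⟨δ⟩ j x y = ℕ∑.∑-δˡ 4 j (λ l → C A l x y)

  private
    ∑₄-reverse : ∀ (g : Fin 4 → ℕ) → ∑ 4 g ≡ ∑ 4 (λ l → g (opposite l))
    ∑₄-reverse g = reverse₄ (g 0F) (g 1F) (g 2F) (g 3F)
      where
      reverse₄ : ∀ a b c d → a + (b + (c + (d + 0))) ≡ d + (c + (b + (a + 0)))
      reverse₄ = solve-∀

  ⟨⟩-swapˡ : ∀ c x y → ⟨ c ⟩ (σ x) y ≡ ⟨ (λ l → c (opposite l)) ⟩ x y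
  ⟨⟩-swapˡ c x y = trans (∑-cong 4 (λ l → cong (c l *_) (C-swapˡ l x y))) (∑₄-reverse (λ l → c l * C A (opposite l) x y))

  ⟨⟩-swapʳ : ∀ c x y → ⟨ c ⟩ x (σ y) ≡ ⟨ (λ l → c (opposite l)) ⟩ x y
  ⟨⟩-swapʳ c x y = trans (∑-cong 4 (λ l → cong (c l *_) (C-swapʳ l x y))) (∑₄-reverse (λ l → c l * C A (opposite l) x y))

  c₁₁ : Fin 4 → ℕ
  c₁₁ = C₁²-coefficients 0 k m

  pᶜ : Fin 4 → Fin 4 → Fin 4 → ℕ
  pᶜ = p̃ 0 1 k m

  private
    only-first : ∀ {S₁ S₂ v} → S₁ ≡ v → S₂ ≡ 0 → S₁ + (S₂ + 0) ≡ v
    only-first refl refl = ℕₚ.+-identityʳ _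

    only-second : ∀ {S₁ S₂ v} → S₁ ≡ 0 → S₂ ≡ v → S₁ + (S₂ + 0) ≡ v
    only-second refl refl = ℕₚ.+-identityʳ _

    ∑-*0 : ∀ (f : Fin m → ℕ) → ∑ m (λ c → f c * 0) ≡ 0
    ∑-*0 f = trans (∑-cong m (λ c → ℕₚ.*-zeroʳ (f c))) (ℕ∑.∑-zero m)

    ∑-*1 : ∀ (f : Fin m → ℕ) → ∑ m (λ c → f c * 1) ≡ ∑ m f
    ∑-*1 f = ∑-cong m (λ c → ℕₚ.*-identityʳ (f c))

    ∑-1* : ∀ (f : Fin m → ℕ) → ∑ m (λ c → 1 * f c) ≡ ∑ m f
    ∑-1* f = ∑-cong m (λ c → ℕₚ.*-identityˡ (f c))

    ∑-1 : ∑ m (λ _ → 1) ≡ m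
    ∑-1 = trans (∑-const m 1) (ℕₚ.*-identityʳ m)

    squares-block : ∀ a b → (A₁ ·ℕ A₁) a b + (A₂ ·ℕ A₂) a b ≡ k * A₁ a b + (k * A₁ b a + (m * 0 + 0))
    squares-block a b = begin
      (A₁ ·ℕ A₁) a b + (A₂ ·ℕ A₂) a b          ≡⟨ A₁²+A₂² a b ⟩
      k * A₁ a b + k * A₂ a b                  ≡⟨ cong (λ t → k * A₁ a b + k * t) (A₂≡A₁ᵀ a b) ⟩
      k * A₁ a b + k * A₁ b a                  ≡⟨ pad (k * A₁ a b) (k * A₁ b a) m ⟩
      k * A₁ a b + (k * A₁ b a + (m * 0 + 0))  ∎
      where
      open ≡-Reasoning
      pad : ∀ x y m → x + y ≡ x + (y + (m * 0 + 0))
      pad = solve-∀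

    mixed-block : ∀ a b → (A₁ ·ℕ A₂) a b + (A₂ ·ℕ A₁) a b + 1 ≡ k * A₂ a b + (k * A₂ b a + (m * δ a b + 0))
    mixed-block a b = begin
      (A₁ ·ℕ A₂) a b + (A₂ ·ℕ A₁) a b + 1          ≡⟨ A₁A₂+A₂A₁+J a b ⟩
      m * δ a b + (k * A₁ a b + k * A₂ a b)        ≡⟨ rotate (m * δ a b) (k * A₁ a b) (k * A₂ a b) ⟩
      k * A₂ a b + (k * A₁ a b + (m * δ a b + 0))  ≡⟨ cong (λ t → k * A₂ a b + (k * t + _)) (A₂≡A₁ᵀ b a) ⟨
      k * A₂ a b + (k * A₂ b a + (m * δ a b + 0))  ∎
      where
      open ≡-Reasoning
      rotate : ∀ x y z → x + (y + z) ≡ z + (y + (x + 0))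
      rotate = solve-∀

  -- C₁² = kC₁ + kC₂ + mC₃, block by block: the border blocks only need the row and column sums of
  -- A₁ and A₂, the inner ones the identities for A₁² + A₂² and A₁A₂ + A₂A₁ + J.
  C₁²ᴮ : ∀ u v → C₁ᴮ u top * C₁ᴮ top v + (∑ m (λ c → C₁ᴮ u (b₁ c) * C₁ᴮ (b₁ c) v)
                   + (∑ m (λ c → C₁ᴮ u (b₂ c) * C₁ᴮ (b₂ c) v) + C₁ᴮ u bot * C₁ᴮ bot v))
                 ≡ ⟨ c₁₁ ⟩ᴮ u v
  C₁²ᴮ top    top    = trans (only-first  (ℕ∑.∑-zero m) (ℕ∑.∑-zero m)) (sym (⟨⟩ᴮ-at c₁₁ 0F top top refl))
  C₁²ᴮ top    (b₁ b) = trans (only-first  (trans (∑-1* _) (A₁-colSum b)) (ℕ∑.∑-zero m)) (sym (⟨⟩ᴮ-at c₁₁ 1F top (b₁ b) refl))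
  C₁²ᴮ top    (b₂ b) = trans (only-first  (trans (∑-1* _) (A₂-colSum b)) (ℕ∑.∑-zero m)) (sym (⟨⟩ᴮ-at c₁₁ 2F top (b₂ b) refl))
  C₁²ᴮ top    bot    = trans (only-first  ∑-1 (ℕ∑.∑-zero m)) (sym (⟨⟩ᴮ-at c₁₁ 3F top bot refl))
  C₁²ᴮ (b₁ a) top    = trans (only-second (∑-*0 (A₁ a)) (trans (∑-*1 _) (A₂-rowSum a))) (sym (⟨⟩ᴮ-at c₁₁ 2F (b₁ a) top refl))
  C₁²ᴮ (b₁ a) (b₁ b) = trans (cong ((A₁ ·ℕ A₁) a b +_) (ℕₚ.+-identityʳ _)) (squares-block a b)
  C₁²ᴮ (b₁ a) (b₂ b) = trans (sym (ℕₚ.+-assoc ((A₁ ·ℕ A₂) a b) ((A₂ ·ℕ A₁) a b) 1)) (mixed-block a b)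
  C₁²ᴮ (b₁ a) bot    = trans (only-first  (trans (∑-*1 _) (A₁-rowSum a)) (∑-*0 (A₂ a))) (sym (⟨⟩ᴮ-at c₁₁ 1F (b₁ a) bot refl))
  C₁²ᴮ (b₂ a) top    = trans (only-second (∑-*0 (A₂ a)) (trans (∑-*1 _) (A₁-rowSum a))) (sym (⟨⟩ᴮ-at c₁₁ 1F (b₂ a) top refl))
  C₁²ᴮ (b₂ a) (b₁ b) = trans (shift1 ((A₁ ·ℕ A₂) a b) ((A₂ ·ℕ A₁) a b)) (mixed-block a b)
    where
    shift1 : ∀ x y → 1 + (y + (x + 0)) ≡ x + y + 1
    shift1 = solve-∀
  C₁²ᴮ (b₂ a) (b₂ b) = trans (trans (cong ((A₂ ·ℕ A₂) a b +_) (ℕₚ.+-identityʳ _)) (ℕₚ.+-comm ((A₂ ·ℕ A₂) a b) _)) (squares-block a b)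
  C₁²ᴮ (b₂ a) bot    = trans (only-first  (trans (∑-*1 _) (A₂-rowSum a)) (∑-*0 (A₁ a))) (sym (⟨⟩ᴮ-at c₁₁ 2F (b₂ a) bot refl))
  C₁²ᴮ bot    top    = trans (only-second (ℕ∑.∑-zero m) ∑-1) (sym (⟨⟩ᴮ-at c₁₁ 3F bot top refl))
  C₁²ᴮ bot    (b₁ b) = trans (only-second (ℕ∑.∑-zero m) (trans (∑-1* _) (A₂-colSum b))) (sym (⟨⟩ᴮ-at c₁₁ 2F bot (b₁ b) refl))
  C₁²ᴮ bot    (b₂ b) = trans (only-second (ℕ∑.∑-zero m) (trans (∑-1* _) (A₁-colSum b))) (sym (⟨⟩ᴮ-at c₁₁ 1F bot (b₂ b) refl))
  C₁²ᴮ bot    bot    = trans (only-first  (ℕ∑.∑-zero m) (ℕ∑.∑-zero m)) (sym (⟨⟩ᴮ-at c₁₁ 0F bot bot refl))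

  C₁² : ∀ x y → (C A 1F ·ℕ C A 1F) x y ≡ ⟨ c₁₁ ⟩ x y
  C₁² x y = begin
    (C A 1F ·ℕ C A 1F) x y    ≡⟨ ∑-blocks (λ w → C₁ᴮ (blk x) w * C₁ᴮ w (blk y)) ⟩
    _                         ≡⟨ C₁²ᴮ (blk x) (blk y) ⟩
    ⟨ c₁₁ ⟩ᴮ (blk x) (blk y)  ≡⟨ ⟨⟩-blocks c₁₁ x y ⟨
    ⟨ c₁₁ ⟩ x y               ∎
    where open ≡-Reasoning

  C₀-· : ∀ (X : Mat (N m)) x y → (C A 0F ·ℕ X) x y ≡ X x y
  C₀-· X x y = ∑-δˡ (N m) x (λ z → X z y)

  ·-C₀ : ∀ (X : Mat (N m)) x y → (X ·ℕ C A 0F) x y ≡ X x y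
  ·-C₀ X x y = ∑-δʳ (N m) y (X x)

  C₃-· : ∀ (X : Mat (N m)) x y → (C A 3F ·ℕ X) x y ≡ X (σ x) y
  C₃-· X x y = trans (∑-cong (N m) (λ z → cong (_* X z y) (sym (C-swapˡ 0F x z)))) (∑-δˡ (N m) (σ x) (λ z → X z y))

  ·-C₃ : ∀ (X : Mat (N m)) x y → (X ·ℕ C A 3F) x y ≡ X x (σ y)
  ·-C₃ X x y = trans (∑-cong (N m) (λ z → cong (X x z *_) (sym (C-swapʳ 0F z y)))) (∑-δʳ (N m) (σ y) (X x))

  C₂-· : ∀ (X : Mat (N m)) x y → (C A 2F ·ℕ X) x y ≡ (C A 1F ·ℕ X) (σ x) y
  C₂-· X x y = ∑-cong (N m) (λ z → cong (_* X z y) (sym (C-swapˡ 1F x z)))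

  ·-C₂ : ∀ (X : Mat (N m)) x y → (X ·ℕ C A 2F) x y ≡ (X ·ℕ C A 1F) x (σ y)
  ·-C₂ X x y = ∑-cong (N m) (λ z → cong (X x z *_) (sym (C-swapʳ 1F z y)))

  -- C₃ is the permutation matrix of σ and C₂ = C₃C₁ = C₁C₃, so every product reduces to C₁².
  C-product : ∀ i j x y → (C A i ·ℕ C A j) x y ≡ ⟨ pᶜ i j ⟩ x y
  C-product 0F j  x y = trans (C₀-· (C A j) x y) (sym (⟨δ⟩ j x y))
  C-product 3F j  x y = trans (C₃-· (C A j) x y) (trans (C-swapˡ j x y) (sym (⟨δ⟩ (opposite j) x y)))
  C-product 1F 0F x y = trans (·-C₀ (C A 1F) x y) (sym (⟨δ⟩ 1F x y))
  C-product 2F 0F x y = trans (·-C₀ (C A 2F) x y) (sym (⟨δ⟩ 2F x y))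
  C-product 1F 3F x y = trans (·-C₃ (C A 1F) x y) (trans (C-swapʳ 1F x y) (sym (⟨δ⟩ 2F x y)))
  C-product 2F 3F x y = trans (·-C₃ (C A 2F) x y) (trans (C-swapʳ 2F x y) (sym (⟨δ⟩ 1F x y)))
  C-product 1F 1F x y = C₁² x y
  C-product 1F 2F x y = trans (·-C₂ (C A 1F) x y) (trans (C₁² x (σ y)) (⟨⟩-swapʳ c₁₁ x y))
  C-product 2F 1F x y = trans (C₂-· (C A 1F) x y) (trans (C₁² (σ x) y) (⟨⟩-swapˡ c₁₁ x y))
  C-product 2F 2F x y = trans (C₂-· (C A 2F) x y) (trans (C-product 1F 2F (σ x) y) (⟨⟩-swapˡ (pᶜ 1F 2F) x y))

  pᶜ-comm : ∀ i j x y → ⟨ pᶜ i j ⟩ x y ≡ ⟨ pᶜ j i ⟩ x y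
  pᶜ-comm 0F 0F x y = refl
  pᶜ-comm 0F 1F x y = refl
  pᶜ-comm 0F 2F x y = refl
  pᶜ-comm 0F 3F x y = refl
  pᶜ-comm 1F 0F x y = refl
  pᶜ-comm 1F 1F x y = refl
  pᶜ-comm 1F 2F x y = refl
  pᶜ-comm 1F 3F x y = refl
  pᶜ-comm 2F 0F x y = refl
  pᶜ-comm 2F 1F x y = refl
  pᶜ-comm 2F 2F x y = refl
  pᶜ-comm 2F 3F x y = refl
  pᶜ-comm 3F 0F x y = refl
  pᶜ-comm 3F 1F x y = refl
  pᶜ-comm 3F 2F x y = refl
  pᶜ-comm 3F 3F x y = refl

  isScheme : IsScheme 3 (N m) (C A)
  isScheme = record
    { zero-one         = λ j x y → ℕₚ.n≤1⇒n≡0∨n≡1 (subst (C A j x y ≤_) (C-sum-is-J x y) (term≤∑ 4 (λ l → C A l x y) j))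
    ; nonzero          = nonzero
    ; A₀-is-I          = λ x y → refl
    ; sum-is-J         = C-sum-is-J
    ; transpose-closed = transpose-closed
    ; product-closed   = λ i j → pᶜ i j , C-product i j
    ; commutative      = λ i j x y → trans (C-product i j x y) (trans (pᶜ-comm i j x y) (sym (C-product j i x y)))
    }
    where
    x̃₁ : Fin (N m)
    x̃₁ = fromBlk (b₁ x₁)

    nonzero : ∀ j → Σ (Fin (N m)) λ x → Σ (Fin (N m)) λ y → C A j x y ≡ 1
    nonzero 0F = zero , zero , refl
    nonzero 1F = zero , x̃₁ , cong (C₁ᴮ top) (blk-fromBlk (b₁ x₁))
    nonzero 2F = x̃₁ , zero , cong (C₁ᴮ top) (blk-fromBlk (b₁ x₁))
    nonzero 3F = zero , fromBlk bot , trans (C-blocks 3F zero (fromBlk bot)) (cong (δᴮ bot) (blk-fromBlk bot))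

    transpose-closed : ∀ i → Σ (Fin 4) λ j → ∀ x y → C A i y x ≡ C A j x y
    transpose-closed 0F = 0F , λ x y → δ-sym y x
    transpose-closed 1F = 2F , λ x y → refl
    transpose-closed 2F = 1F , λ x y → refl
    transpose-closed 3F = 3F , λ x y →
      cong₂ (λ a b → 1 ∸ (a + b)) (δ-sym y x) (ℕₚ.+-comm (C₁ᴮ (blk y) (blk x)) _)

-- Primitive idempotents

module PrimitiveIdempotents {m} {A : Fin 3 → Mat m} (scheme : IsScheme 2 m A)
                            (A₂≡A₁ᵀ : ∀ x y → A 2F x y ≡ A 1F y x) where
  open ClassTwo scheme A₂≡A₁ᵀ using (k; m≡1+2k)
  open DoubleCover scheme A₂≡A₁ᵀ
  open QuadraticField m

  ⟪_⟫ : (Fin 4 → K) → KMat m (N m)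
  ⟪ c ⟫ x y = sumK m 4 (λ l → c l *ᴷ ι (C A l x y))

  p̃ᴷ : Fin 4 → Fin 4 → Fin 4 → K
  p̃ᴷ = p̃ 0ᴷ 1ᴷ (ι k) (ι m)

  infixl 7 _⋆_
  _⋆_ : (Fin 4 → K) → (Fin 4 → K) → Fin 4 → K
  (c ⋆ d) l = ∑ᴷ.∑ 4 (λ a → ∑ᴷ.∑ 4 (λ b → (c a *ᴷ d b) *ᴷ p̃ᴷ a b l))

  ι-C-product : ∀ a b x y → ∑ᴷ.∑ (N m) (λ z → ι (C A a x z) *ᴷ ι (C A b z y)) ≡ ∑ᴷ.∑ 4 (λ l → p̃ᴷ a b l *ᴷ ι (C A l x y))
  ι-C-product a b x y = begin
    ∑ᴷ.∑ (N m) (λ z → ι (C A a x z) *ᴷ ι (C A b z y))  ≡⟨ ∑ᴷ.∑-cong (N m) (λ z → ι-* (C A a x z) (C A b z y)) ⟨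
    ∑ᴷ.∑ (N m) (λ z → ι (C A a x z * C A b z y))       ≡⟨ ι-∑ (N m) (λ z → C A a x z * C A b z y) ⟨
    ι ((C A a ·ℕ C A b) x y)                           ≡⟨ cong ι (C-product a b x y) ⟩
    ι (⟨ pᶜ a b ⟩ x y)                                 ≡⟨ ι-∑ 4 (λ l → pᶜ a b l * C A l x y) ⟩
    ∑ᴷ.∑ 4 (λ l → ι (pᶜ a b l * C A l x y))            ≡⟨ ∑ᴷ.∑-cong 4 (λ l → trans (ι-* (pᶜ a b l) (C A l x y)) (cong (_*ᴷ ι (C A l x y)) (p̃-map ι a b l))) ⟩
    ∑ᴷ.∑ 4 (λ l → p̃ᴷ a b l *ᴷ ι (C A l x y))           ∎
    where open ≡-Reasoning

  ⟪⟫-product : ∀ c d x y → _·K_ m ⟪ c ⟫ ⟪ d ⟫ x y ≡ ⟪ c ⋆ d ⟫ x y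
  ⟪⟫-product c d x y = begin
    _·K_ m ⟪ c ⟫ ⟪ d ⟫ x y
      ≡⟨ ∑ᴷ.∑-bilinear (N m) 4 4 c d (λ a z → ι (C A a x z)) (λ b z → ι (C A b z y)) ⟩
    ∑ᴷ.∑ 4 (λ a → ∑ᴷ.∑ 4 (λ b → (c a *ᴷ d b) *ᴷ ∑ᴷ.∑ (N m) (λ z → ι (C A a x z) *ᴷ ι (C A b z y))))
      ≡⟨ ∑ᴷ.∑-cong 4 (λ a → ∑ᴷ.∑-cong 4 (λ b → expand a b)) ⟩
    ∑ᴷ.∑ 4 (λ a → ∑ᴷ.∑ 4 (λ b → ∑ᴷ.∑ 4 (λ l → ((c a *ᴷ d b) *ᴷ p̃ᴷ a b l) *ᴷ ι (C A l x y))))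
      ≡⟨ ∑ᴷ.∑³-factorʳ 4 4 4 (λ a b l → (c a *ᴷ d b) *ᴷ p̃ᴷ a b l) (λ l → ι (C A l x y)) ⟩
    ⟪ c ⋆ d ⟫ x y ∎
    where
    open ≡-Reasoning
    expand : ∀ a b → (c a *ᴷ d b) *ᴷ ∑ᴷ.∑ (N m) (λ z → ι (C A a x z) *ᴷ ι (C A b z y)) ≡
                     ∑ᴷ.∑ 4 (λ l → ((c a *ᴷ d b) *ᴷ p̃ᴷ a b l) *ᴷ ι (C A l x y))
    expand a b = begin
      (c a *ᴷ d b) *ᴷ ∑ᴷ.∑ (N m) (λ z → ι (C A a x z) *ᴷ ι (C A b z y))
        ≡⟨ cong ((c a *ᴷ d b) *ᴷ_) (ι-C-product a b x y) ⟩
      (c a *ᴷ d b) *ᴷ ∑ᴷ.∑ 4 (λ l → p̃ᴷ a b l *ᴷ ι (C A l x y))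
        ≡⟨ ∑ᴷ.*-distribˡ-∑ 4 (c a *ᴷ d b) (λ l → p̃ᴷ a b l *ᴷ ι (C A l x y)) ⟩
      ∑ᴷ.∑ 4 (λ l → (c a *ᴷ d b) *ᴷ (p̃ᴷ a b l *ᴷ ι (C A l x y)))
        ≡⟨ ∑ᴷ.∑-cong 4 (λ l → *ᴷ-assoc (c a *ᴷ d b) (p̃ᴷ a b l) (ι (C A l x y))) ⟨
      ∑ᴷ.∑ 4 (λ l → ((c a *ᴷ d b) *ᴷ p̃ᴷ a b l) *ᴷ ι (C A l x y)) ∎

  ⟪⟫-cong : ∀ {c d} → (∀ l → c l ≡ d l) → ∀ x y → ⟪ c ⟫ x y ≡ ⟪ d ⟫ x y
  ⟪⟫-cong c≗d x y = ∑ᴷ.∑-cong 4 (λ l → cong (_*ᴷ ι (C A l x y)) (c≗d l))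

  ⟪⟫-scale : ∀ a c x y → ⟪ (λ l → a *ᴷ c l) ⟫ x y ≡ a *ᴷ ⟪ c ⟫ x y
  ⟪⟫-scale a c x y = trans (∑ᴷ.∑-cong 4 (λ l → *ᴷ-assoc a (c l) (ι (C A l x y)))) (sym (∑ᴷ.*-distribˡ-∑ 4 a (λ l → c l *ᴷ ι (C A l x y))))

  ⟪⟫-at : ∀ c {l} x y → C A l x y ≡ 1 → ⟪ c ⟫ x y ≡ c l
  ⟪⟫-at c {l} x y Clxy≡1 = begin
    ⟪ c ⟫ x y                        ≡⟨ ∑ᴷ.∑-cong 4 (λ j → cong (λ t → c j *ᴷ ι t) (∑≡1⇒δ 4 (λ j → C A j x y) {l} (C-sum-is-J x y) Clxy≡1 j)) ⟩
    ∑ᴷ.∑ 4 (λ j → c j *ᴷ ι (δ l j))  ≡⟨ ∑ᴷ.∑-cong 4 (λ j → trans (*ᴷ-comm (c j) (ι (δ l j))) (cong (_*ᴷ c j) (ι-δ l j))) ⟩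
    ∑ᴷ.∑ 4 (λ j → ∑ᴷ.δ# l j *ᴷ c j)  ≡⟨ ∑ᴷ.∑-δˡ 4 l c ⟩
    c l                              ∎
    where open ≡-Reasoning

  -- 4 * suc (k + k) is 4m written so that the division sees that it is nonzero.
  ν⁻¹₀ ν⁻¹₁ : K
  ν⁻¹₀ = (ℤ.+ 1 ℚ./ N m) + 0ℚ √
  ν⁻¹₁ = (ℤ.+ 1 ℚ./ (4 * suc (k + k))) + 0ℚ √

  -- Identities in K are checked with k, ν⁻¹₀ and ν⁻¹₁ as (real) variables and m read as 1 + 2k.
  ρ : Vec K 3
  ρ = ι k ∷ ν⁻¹₀ ∷ ν⁻¹₁ ∷ []

  M : Q.Polynomial (3 + 3)
  M = Q.con 1ℚ Q.:+ (Q.var zero Q.:+ Q.var zero)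

  M≡m : Q.⟦ M ⟧ (env ρ) ≡ toℚ m
  M≡m = sym (begin
    toℚ m                     ≡⟨ cong toℚ m≡1+2k ⟩
    toℚ (1 + (k + k))         ≡⟨ toℚ-+ 1 (k + k) ⟩
    1ℚ ℚ.+ toℚ (k + k)        ≡⟨ cong (1ℚ ℚ.+_) (toℚ-+ k k) ⟩
    1ℚ ℚ.+ (toℚ k ℚ.+ toℚ k)  ∎)
    where open ≡-Reasoning

  solve : ∀ l r → normal M ρ l ≡ normal M ρ r → ⟦ l ⟧ ρ ≡ ⟦ r ⟧ ρ
  solve = K-solve M ρ M≡m

  k̂ : KExpr 3
  k̂ = real 0F

  Σ̂ : ∀ n → (Fin n → KExpr 3) → KExpr 3
  Σ̂ = Σ[<_]_ (rat 0ℚ) _:+_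

  δ̂ : Fin 4 → Fin 4 → KExpr 3
  δ̂ = kronecker (rat 0ℚ) (rat 1ℚ)

  infixl 7 _⋆̂_
  _⋆̂_ : (Fin 4 → KExpr 3) → (Fin 4 → KExpr 3) → Fin 4 → KExpr 3
  (c ⋆̂ d) l = Σ̂ 4 (λ a → Σ̂ 4 (λ b → (c a :* d b) :* p̃ (rat 0ℚ) (rat 1ℚ) k̂ m̂ a b l))

  ⋆̂-sound : ∀ c d l → ⟦ (c ⋆̂ d) l ⟧ ρ ≡ ((λ a → ⟦ c a ⟧ ρ) ⋆ (λ b → ⟦ d b ⟧ ρ)) l
  ⋆̂-sound c d l = ∑ᴷ.∑-cong 4 (λ a → ∑ᴷ.∑-cong 4 (λ b →
    cong ((⟦ c a ⟧ ρ *ᴷ ⟦ d b ⟧ ρ) *ᴷ_) (p̃-map (λ e → ⟦ e ⟧ ρ) {rat 0ℚ} {rat 1ℚ} {k̂} {m̂} a b l)))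

  -- Each row F̂ i is a multiple of l ↦ conj(P i l) / P 0F l, as in the usual formula for the
  -- primitive idempotents, and F̂ i ⋆̂ F̂ i = ν̂ i F̂ i.
  F̂ : Fin 4 → Fin 4 → KExpr 3
  F̂ 0F _  = rat 1ℚ
  F̂ 1F 0F = m̂
  F̂ 1F 1F = :- √-m
  F̂ 1F 2F = √-m
  F̂ 1F 3F = :- m̂
  F̂ 2F 0F = m̂
  F̂ 2F 1F = √-m
  F̂ 2F 2F = :- √-m
  F̂ 2F 3F = :- m̂
  F̂ 3F 0F = m̂
  F̂ 3F 1F = :- rat 1ℚ
  F̂ 3F 2F = :- rat 1ℚ
  F̂ 3F 3F = m̂

  ν̂ ν̂⁻¹ : Fin 4 → KExpr 3
  ν̂ 0F = rat 1ℚ :+ (m̂ :+ (m̂ :+ rat 1ℚ))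
  ν̂ 1F = rat (toℚ 4) :* m̂
  ν̂ 2F = rat (toℚ 4) :* m̂
  ν̂ 3F = rat 1ℚ :+ (m̂ :+ (m̂ :+ rat 1ℚ))
  ν̂⁻¹ 0F = real 1F
  ν̂⁻¹ 1F = real 2F
  ν̂⁻¹ 2F = real 2F
  ν̂⁻¹ 3F = real 1F

  F : Fin 4 → Fin 4 → K
  F i l = ⟦ F̂ i l ⟧ ρ

  ν ν⁻¹ : Fin 4 → K
  ν i = ⟦ ν̂ i ⟧ ρ
  ν⁻¹ i = ⟦ ν̂⁻¹ i ⟧ ρ

  ν⁻¹*ν≡1 : ∀ i → ν⁻¹ i *ᴷ ν i ≡ 1ᴷ
  ν⁻¹*ν≡1 = fin4-cases ν⁻¹₀*ν₀≡1 ν⁻¹₁*ν₁≡1 ν⁻¹₁*ν₁≡1 ν⁻¹₀*ν₀≡1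
    where
    ν⁻¹₀*ν₀≡1 : ν⁻¹₀ *ᴷ ν 0F ≡ 1ᴷ
    ν⁻¹₀*ν₀≡1 = trans (cong (ν⁻¹₀ *ᴷ_) (sym (trans (ι-+ 1 (m + (m + 1))) (cong (1ᴷ +ᴷ_) (trans (ι-+ m (m + 1)) (cong (ι m +ᴷ_) (ι-+ m 1)))))))
                      (1/n*ᴷn≡1 (N m))
    ν⁻¹₁*ν₁≡1 : ν⁻¹₁ *ᴷ ν 1F ≡ 1ᴷ
    ν⁻¹₁*ν₁≡1 = trans (cong (ν⁻¹₁ *ᴷ_) (trans (sym (ι-* 4 m)) (cong (λ t → ι (4 * t)) m≡1+2k)))
                      (1/n*ᴷn≡1 (4 * suc (k + k)))

  F̂-orthogonal : ∀ i j l → normal M ρ ((F̂ i ⋆̂ F̂ j) l) ≡ normal M ρ (δ̂ i j :* (ν̂ i :* F̂ i l))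
  F̂-orthogonal = fin4-cases
    (fin4-cases (fin4-cases refl refl refl refl) (fin4-cases refl refl refl refl) (fin4-cases refl refl refl refl) (fin4-cases refl refl refl refl))
    (fin4-cases (fin4-cases refl refl refl refl) (fin4-cases refl refl refl refl) (fin4-cases refl refl refl refl) (fin4-cases refl refl refl refl))
    (fin4-cases (fin4-cases refl refl refl refl) (fin4-cases refl refl refl refl) (fin4-cases refl refl refl refl) (fin4-cases refl refl refl refl))
    (fin4-cases (fin4-cases refl refl refl refl) (fin4-cases refl refl refl refl) (fin4-cases refl refl refl refl) (fin4-cases refl refl refl refl))

  F-orthogonal : ∀ i j l → (F i ⋆ F j) l ≡ ∑ᴷ.δ# i j *ᴷ (ν i *ᴷ F i l)
  F-orthogonal i j l = begin
    (F i ⋆ F j) l                  ≡⟨ ⋆̂-sound (F̂ i) (F̂ j) l ⟨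
    ⟦ (F̂ i ⋆̂ F̂ j) l ⟧ ρ            ≡⟨ solve ((F̂ i ⋆̂ F̂ j) l) (δ̂ i j :* (ν̂ i :* F̂ i l)) (F̂-orthogonal i j l) ⟩
    ⟦ δ̂ i j ⟧ ρ *ᴷ (ν i *ᴷ F i l)  ≡⟨ cong (_*ᴷ (ν i *ᴷ F i l)) (kronecker-map (λ e → ⟦ e ⟧ ρ) i j) ⟩
    ∑ᴷ.δ# i j *ᴷ (ν i *ᴷ F i l)    ∎
    where open ≡-Reasoning

  E : Fin 4 → KMat m (N m)
  E i x y = ν⁻¹ i *ᴷ ⟪ F i ⟫ x y

  E-in-algebra : ∀ i x y → E i x y ≡ sumK m 4 (λ l → (ν⁻¹ i *ᴷ F i l) *ᴷ embed m (C A l) x y)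
  E-in-algebra i x y = sym (⟪⟫-scale (ν⁻¹ i) (F i) x y)

  E₀-is-J/n : ∀ x y → E 0F x y ≡ ν⁻¹₀
  E₀-is-J/n x y = begin
    ν⁻¹₀ *ᴷ ⟪ F 0F ⟫ x y                  ≡⟨ cong (ν⁻¹₀ *ᴷ_) (∑ᴷ.∑-cong 4 (λ l → *ᴷ-identityˡ (ι (C A l x y)))) ⟩
    ν⁻¹₀ *ᴷ ∑ᴷ.∑ 4 (λ l → ι (C A l x y))  ≡⟨ cong (ν⁻¹₀ *ᴷ_) (ι-∑ 4 (λ l → C A l x y)) ⟨
    ν⁻¹₀ *ᴷ ι (∑ 4 (λ l → C A l x y))     ≡⟨ cong (λ t → ν⁻¹₀ *ᴷ ι t) (C-sum-is-J x y) ⟩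
    ν⁻¹₀ *ᴷ 1ᴷ                            ≡⟨ *ᴷ-comm ν⁻¹₀ 1ᴷ ⟩
    1ᴷ *ᴷ ν⁻¹₀                            ≡⟨ *ᴷ-identityˡ ν⁻¹₀ ⟩
    ν⁻¹₀                                  ∎
    where open ≡-Reasoning

  E-orthogonal : ∀ i j x y → _·K_ m (E i) (E j) x y ≡ ι (δ i j) *ᴷ E i x y
  E-orthogonal i j x y = begin
    _·K_ m (E i) (E j) x y
      ≡⟨ ∑ᴷ.∑-pull-scalars (N m) (ν⁻¹ i) (ν⁻¹ j) (λ z → ⟪ F i ⟫ x z) (λ z → ⟪ F j ⟫ z y) ⟩
    (ν⁻¹ i *ᴷ ν⁻¹ j) *ᴷ _·K_ m ⟪ F i ⟫ ⟪ F j ⟫ x y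
      ≡⟨ cong ((ν⁻¹ i *ᴷ ν⁻¹ j) *ᴷ_) (trans (⟪⟫-product (F i) (F j) x y) (⟪⟫-cong (F-orthogonal i j) x y)) ⟩
    (ν⁻¹ i *ᴷ ν⁻¹ j) *ᴷ ⟪ (λ l → ∑ᴷ.δ# i j *ᴷ (ν i *ᴷ F i l)) ⟫ x y
      ≡⟨ cong ((ν⁻¹ i *ᴷ ν⁻¹ j) *ᴷ_) (trans (⟪⟫-cong (λ l → sym (*ᴷ-assoc (∑ᴷ.δ# i j) (ν i) (F i l))) x y)
                                            (⟪⟫-scale (∑ᴷ.δ# i j *ᴷ ν i) (F i) x y)) ⟩
    (ν⁻¹ i *ᴷ ν⁻¹ j) *ᴷ ((∑ᴷ.δ# i j *ᴷ ν i) *ᴷ ⟪ F i ⟫ x y)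
      ≡⟨ orthogonal-scaling i j ν⁻¹ (ν i) (⟪ F i ⟫ x y) (ν⁻¹*ν≡1 i) ⟩
    ι (δ i j) *ᴷ E i x y ∎
    where open ≡-Reasoning

  P̂ : Fin 4 → Fin 4 → KExpr 3
  P̂ 0F 0F = rat 1ℚ
  P̂ 0F 1F = m̂
  P̂ 0F 2F = m̂
  P̂ 0F 3F = rat 1ℚ
  P̂ 1F 0F = rat 1ℚ
  P̂ 1F 1F = √-m
  P̂ 1F 2F = :- √-m
  P̂ 1F 3F = :- rat 1ℚ
  P̂ 2F 0F = rat 1ℚ
  P̂ 2F 1F = :- √-m
  P̂ 2F 2F = √-m
  P̂ 2F 3F = :- rat 1ℚ
  P̂ 3F 0F = rat 1ℚ
  P̂ 3F 1F = :- rat 1ℚ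
  P̂ 3F 2F = :- rat 1ℚ
  P̂ 3F 3F = rat 1ℚ

  P≡⟦P̂⟧ : ∀ i j → P m i j ≡ ⟦ P̂ i j ⟧ ρ
  P≡⟦P̂⟧ = fin4-cases (fin4-cases refl refl refl refl) (fin4-cases refl refl refl refl) (fin4-cases refl refl refl refl) (fin4-cases refl refl refl refl)

  -- In column j, the rows 0F and 3F contribute α̂ j l and the rows 1F and 2F contribute β̂ j l,
  -- once the factors ν⁻¹ i are cancelled.
  α̂ β̂ : Fin 4 → Fin 4 → KExpr 3
  α̂ j l = rat (ℤ.+ 1 ℚ./ 2) :* (δ̂ j l :+ δ̂ (opposite j) l)
  β̂ j l = rat (ℤ.+ 1 ℚ./ 2) :* (δ̂ j l :+ :- δ̂ (opposite j) l)

  P̂-columns : ∀ j l → normal M ρ (Σ̂ 4 (λ i → P̂ i j :* (ν̂⁻¹ i :* F̂ i l))) ≡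
                      normal M ρ (ν̂⁻¹ 0F :* (ν̂ 0F :* α̂ j l) :+ ν̂⁻¹ 1F :* (ν̂ 1F :* β̂ j l))
  P̂-columns = fin4-cases (fin4-cases refl refl refl refl) (fin4-cases refl refl refl refl) (fin4-cases refl refl refl refl) (fin4-cases refl refl refl refl)

  P-columns : ∀ j l → ∑ᴷ.∑ 4 (λ i → P m i j *ᴷ (ν⁻¹ i *ᴷ F i l)) ≡ ∑ᴷ.δ# j l
  P-columns j l = begin
    ∑ᴷ.∑ 4 (λ i → P m i j *ᴷ (ν⁻¹ i *ᴷ F i l))
      ≡⟨ ∑ᴷ.∑-cong 4 (λ i → cong (_*ᴷ (ν⁻¹ i *ᴷ F i l)) (P≡⟦P̂⟧ i j)) ⟩
    ⟦ Σ̂ 4 (λ i → P̂ i j :* (ν̂⁻¹ i :* F̂ i l)) ⟧ ρ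
      ≡⟨ solve (Σ̂ 4 (λ i → P̂ i j :* (ν̂⁻¹ i :* F̂ i l))) (ν̂⁻¹ 0F :* (ν̂ 0F :* α̂ j l) :+ ν̂⁻¹ 1F :* (ν̂ 1F :* β̂ j l)) (P̂-columns j l) ⟩
    ν⁻¹ 0F *ᴷ (ν 0F *ᴷ ⟦ α̂ j l ⟧ ρ) +ᴷ ν⁻¹ 1F *ᴷ (ν 1F *ᴷ ⟦ β̂ j l ⟧ ρ)
      ≡⟨ cong₂ _+ᴷ_ (inverse-cancel (ν⁻¹ 0F) (ν 0F) (⟦ α̂ j l ⟧ ρ) (ν⁻¹*ν≡1 0F)) (inverse-cancel (ν⁻¹ 1F) (ν 1F) (⟦ β̂ j l ⟧ ρ) (ν⁻¹*ν≡1 1F)) ⟩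
    ⟦ α̂ j l ⟧ ρ +ᴷ ⟦ β̂ j l ⟧ ρ
      ≡⟨ halves (⟦ δ̂ j l ⟧ ρ) (⟦ δ̂ (opposite j) l ⟧ ρ) ⟩
    ⟦ δ̂ j l ⟧ ρ
      ≡⟨ kronecker-map (λ e → ⟦ e ⟧ ρ) j l ⟩
    ∑ᴷ.δ# j l ∎
    where open ≡-Reasoning

  first-eigenmatrix : HasFirstEigenmatrix m (C A) E
  first-eigenmatrix j x y = begin
    ι (C A j x y)
      ≡⟨ ∑ᴷ.∑-δˡ 4 j (λ l → ι (C A l x y)) ⟨
    ∑ᴷ.∑ 4 (λ l → ∑ᴷ.δ# j l *ᴷ ι (C A l x y))
      ≡⟨ ∑ᴷ.∑-cong 4 (λ l → cong (_*ᴷ ι (C A l x y)) (P-columns j l)) ⟨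
    ∑ᴷ.∑ 4 (λ l → ∑ᴷ.∑ 4 (λ i → P m i j *ᴷ (ν⁻¹ i *ᴷ F i l)) *ᴷ ι (C A l x y))
      ≡⟨ ∑ᴷ.∑-cong 4 (λ l → ∑ᴷ.*-distribʳ-∑ 4 (ι (C A l x y)) (λ i → P m i j *ᴷ (ν⁻¹ i *ᴷ F i l))) ⟩
    ∑ᴷ.∑ 4 (λ l → ∑ᴷ.∑ 4 (λ i → (P m i j *ᴷ (ν⁻¹ i *ᴷ F i l)) *ᴷ ι (C A l x y)))
      ≡⟨ ∑ᴷ.∑-comm 4 4 (λ l i → (P m i j *ᴷ (ν⁻¹ i *ᴷ F i l)) *ᴷ ι (C A l x y)) ⟩
    ∑ᴷ.∑ 4 (λ i → ∑ᴷ.∑ 4 (λ l → (P m i j *ᴷ (ν⁻¹ i *ᴷ F i l)) *ᴷ ι (C A l x y)))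
      ≡⟨ ∑ᴷ.∑-cong 4 (λ i → trans (∑ᴷ.∑-cong 4 (λ l → *ᴷ-assoc (P m i j) (ν⁻¹ i *ᴷ F i l) (ι (C A l x y))))
                                  (sym (∑ᴷ.*-distribˡ-∑ 4 (P m i j) (λ l → (ν⁻¹ i *ᴷ F i l) *ᴷ ι (C A l x y))))) ⟩
    ∑ᴷ.∑ 4 (λ i → P m i j *ᴷ ⟪ (λ l → ν⁻¹ i *ᴷ F i l) ⟫ x y)
      ≡⟨ ∑ᴷ.∑-cong 4 (λ i → cong (P m i j *ᴷ_) (⟪⟫-scale (ν⁻¹ i) (F i) x y)) ⟩
    ∑ᴷ.∑ 4 (λ i → P m i j *ᴷ E i x y) ∎
    where open ≡-Reasoning

  E-sum-is-I : ∀ x y → sumK m 4 (λ i → E i x y) ≡ ι (δ x y)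
  E-sum-is-I x y = sym (trans (first-eigenmatrix 0F x y)
    (∑ᴷ.∑-cong 4 {λ i → P m i 0F *ᴷ E i x y} {λ i → E i x y} (fin4-cases (*ᴷ-identityˡ (E 0F x y)) (*ᴷ-identityˡ (E 1F x y)) (*ᴷ-identityˡ (E 2F x y)) (*ᴷ-identityˡ (E 3F x y)))))

  -- At a pair in relation 1F, E i is ν⁻¹ i * F i 1F, and Ŵ i = ν̂ i / F̂ i 1F is its inverse up to ν̂ i.
  Ŵ : Fin 4 → KExpr 3
  Ŵ 0F = ν̂ 0F
  Ŵ 1F = rat (toℚ 4) :* √-m
  Ŵ 2F = :- (rat (toℚ 4) :* √-m)
  Ŵ 3F = :- ν̂ 0F

  F̂₁-invertible : ∀ i → normal M ρ (F̂ i 1F :* Ŵ i) ≡ normal M ρ (ν̂ i)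
  F̂₁-invertible = fin4-cases refl refl refl refl

  E-nonzero : ∀ i → Σ (Fin (N m)) λ x → Σ (Fin (N m)) λ y → E i x y ≢ 0ᴷ
  E-nonzero i = x₀ , y₀ , λ Eᵢx₀y₀≡0 → 1ᴷ≢0ᴷ (begin
    1ᴷ                      ≡⟨ ν⁻¹*ν≡1 i ⟨
    ν⁻¹ i *ᴷ ν i            ≡⟨ cong (ν⁻¹ i *ᴷ_) (solve (F̂ i 1F :* Ŵ i) (ν̂ i) (F̂₁-invertible i)) ⟨
    ν⁻¹ i *ᴷ (F i 1F *ᴷ W)  ≡⟨ *ᴷ-assoc (ν⁻¹ i) (F i 1F) W ⟨
    (ν⁻¹ i *ᴷ F i 1F) *ᴷ W  ≡⟨ cong (λ t → (ν⁻¹ i *ᴷ t) *ᴷ W) (⟪⟫-at (F i) x₀ y₀ C₁x₀y₀≡1) ⟨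
    E i x₀ y₀ *ᴷ W          ≡⟨ cong (_*ᴷ W) Eᵢx₀y₀≡0 ⟩
    0ᴷ *ᴷ W                 ≡⟨ *ᴷ-zeroˡ W ⟩
    0ᴷ                      ∎)
    where
    open ≡-Reasoning
    open IsScheme isScheme using (nonzero)
    x₀ y₀ : Fin (N m)
    x₀ = proj₁ (nonzero 1F)
    y₀ = proj₁ (proj₂ (nonzero 1F))
    C₁x₀y₀≡1 : C A 1F x₀ y₀ ≡ 1
    C₁x₀y₀≡1 = proj₂ (proj₂ (nonzero 1F))
    W : K
    W = ⟦ Ŵ i ⟧ ρ

  isPrimitiveIdempotentBasis : IsPrimitiveIdempotentBasis m (N m) (C A) E
  isPrimitiveIdempotentBasis = record
    { E₀-is-J/n             = E₀-is-J/n
    ; in-algebra            = λ i → (λ l → ν⁻¹ i *ᴷ F i l) , E-in-algebra i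
    ; orthogonal-idempotent = E-orthogonal
    ; nonzero               = E-nonzero
    ; sum-is-I              = E-sum-is-I
    }

theorem4p1 : (m : ℕ) → 1 ≤ m → (A : Fin 3 → Mat m) →
    IsScheme 2 m A → NonSymmetric A →
    (∀ x y → A (suc (suc zero)) x y ≡ A (suc zero) y x) →
    IsScheme 3 (N m) (C A) ×
    Σ (Fin 4 → KMat m (N m)) (λ E →
      IsPrimitiveIdempotentBasis m (N m) (C A) E × HasFirstEigenmatrix m (C A) E)
theorem4p1 m _ A scheme _ A₂≡A₁ᵀ = isScheme , E , isPrimitiveIdempotentBasis , first-eigenmatrix
  where
  open DoubleCover scheme A₂≡A₁ᵀ using (isScheme)
  open PrimitiveIdempotents scheme A₂≡A₁ᵀ using (E; isPrimitiveIdempotentBasis; first-eigenmatrix)
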